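{- Let $n\ge2$, $a_1,\ldots,a_{n-1}$ positive integers, $\lambda=\sum a_i\omega_i$, let $x$ be a simple vertex of $P_\lambda$ and $d$ a Dyck path with $S(x,d)=M(\lambda,d)$. Then $x_{i,j}\neq0$ for every peak and every valley $(i,j)$ of $d$.
   Context: $U=\mathbb R^{\binom n2}$ with coordinates $x_{i,j}$, $1\le i<j\le n$. A Dyck path is a sequence $d=((i_1,j_1),\ldots,(i_N,j_N))$ of pairs with $1\le i_k<j_k\le n$, $j_1-i_1=j_N-i_N=1$, and each $(i_{k+1},j_{k+1})$ equal to $(i_k+1,j_k)$ or $(i_k,j_k+1)$. $S(x,d)=\sum_{(i,j)\in d}x_{i,j}$, $M(\lambda,d)=a_{i_1}+a_{i_1+1}+\ldots+a_{i_N}$, $P_\lambda=\{x\in U:x\ge0,\ S(x,d)\le M(\lambda,d)\ \forall d\}$. $(i,j)\in d$ is a peak if $(i,j-1),(i+1,j)\in d$ and a valley if $(i-1,j),(i,j+1)\in d$. A vertex is simple if the tangent cone at it is simplicial and unimodular.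
   Formalization: The points of $U$, including the vertex $x$, have rational coordinates instead of real ones, and the tangent cone is taken over ℚ, with rational scalars and rational coefficients for its generators. -}

module Defs where

open import Data.Nat as ℕ using (ℕ; zero; suc; _∸_)
open import Data.Integer as ℤ using (ℤ)
open import Data.Rational as ℚ using (ℚ; 0ℚ; 1ℚ)
open import Data.Product using (_×_; _,_; Σ; proj₁; proj₂)
open import Data.Sum using (_⊎_)
open import Data.List using (List; []; _∷_; map; concatMap; foldr; last)
open import Data.List.Relation.Unary.All using (All)
open import Data.List.Relation.Unary.Linked using (Linked)
open import Data.List.Membership.Propositional using (_∈_)
open import Data.Maybe using (Maybe; just)
open import Relation.Binary.PropositionalEquality using (_≡_)
open import Function using (_⇔_)
open import Relation.Nullary using (¬_)
import Data.Empty

-- Coordinates x_{i,j} of U = ℝ^(n choose 2), indexed by pairs (i , j) of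
-- natural numbers with 1 ≤ i < j ≤ n (1-based, as in the paper).
Pair : Set
Pair = ℕ × ℕ

Valid : ℕ → Pair → Set
Valid n (i , j) = (1 ℕ.≤ i) × (i ℕ.< j) × (j ℕ.≤ n)

range : ℕ → ℕ → List ℕ
range a b = Data.List.applyUpTo (λ k → a ℕ.+ k) (suc b ∸ a)

pairs : ℕ → List Pair
pairs n = concatMap (λ j → map (λ i → (i , j)) (range 1 (j ∸ 1))) (range 2 n)

-- (rational) points of U; only the coordinates with Valid n matter
Vect : Set
Vect = Pair → ℚ

sumℚ : List ℚ → ℚ
sumℚ = foldr ℚ._+_ 0ℚ

sumℕ : List ℕ → ℕ
sumℕ = foldr ℕ._+_ 0

_≈[_]_ : Vect → ℕ → Vect → Set
x ≈[ n ] y = ∀ p → Valid n p → x p ≡ y p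

Step : Pair → Pair → Set
Step (i , j) (i' , j') = ((i' ≡ suc i) × (j' ≡ j)) ⊎ ((i' ≡ i) × (j' ≡ suc j))

StartsOnDiag : List Pair → Set
StartsOnDiag []              = Data.Empty.⊥
StartsOnDiag ((i , j) ∷ _)   = j ≡ suc i

EndsOnDiag : List Pair → Set
EndsOnDiag d = Σ ℕ (λ i → last d ≡ just (i , suc i))

IsDyck : ℕ → List Pair → Set
IsDyck n d = All (Valid n) d × Linked Step d × StartsOnDiag d × EndsOnDiag d

S : Vect → List Pair → ℚ
S x d = sumℚ (map x d)

firstRow : List Pair → ℕ
firstRow []             = 0
firstRow ((i , _) ∷ _)  = i

lastRow : List Pair → ℕ
lastRow []              = 0
lastRow (p ∷ [])        = proj₁ p
lastRow (_ ∷ q ∷ d)     = lastRow (q ∷ d)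

-- M(λ,d) = a_{i_1} + a_{i_1+1} + … + a_{i_N}, for λ = Σ a_i ω_i given by a
M : (ℕ → ℕ) → List Pair → ℚ
M a d = (ℤ.+ sumℕ (map a (range (firstRow d) (lastRow d)))) ℚ./ 1

InP : ℕ → (ℕ → ℕ) → Vect → Set
InP n a x = (∀ p → Valid n p → 0ℚ ℚ.≤ x p)
          × (∀ d → IsDyck n d → S x d ℚ.≤ M a d)

IsVertex : ℕ → (ℕ → ℕ) → Vect → Set
IsVertex n a x = InP n a x
  × (∀ y z → InP n a y → InP n a z →
       (λ p → x p ℚ.+ x p) ≈[ n ] (λ p → y p ℚ.+ z p) → y ≈[ n ] z)

InTangentCone : ℕ → (ℕ → ℕ) → Vect → Vect → Set
InTangentCone n a x v = Σ ℚ (λ t → (0ℚ ℚ.< t) × InP n a (λ p → x p ℚ.+ t ℚ.* v p))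

IntMatrix : Set
IntMatrix = Pair → Pair → ℤ

toℚ : ℤ → ℚ
toℚ z = z ℚ./ 1

_·ᵥ_[_] : IntMatrix → Vect → ℕ → Vect
(V ·ᵥ c [ n ]) r = sumℚ (map (λ s → toℚ (V r s) ℚ.* c s) (pairs n))

matMul : ℕ → IntMatrix → IntMatrix → IntMatrix
matMul n A B r t = foldr ℤ._+_ (ℤ.+ 0) (map (λ s → A r s ℤ.* B s t) (pairs n))

IsRightInverse : ℕ → IntMatrix → IntMatrix → Set
IsRightInverse n A B = ∀ r t → Valid n r → Valid n t →
  (r ≡ t → matMul n A B r t ≡ ℤ.+ 1) × (¬ (r ≡ t) → matMul n A B r t ≡ ℤ.+ 0)

-- The tangent cone at x is simplicial and unimodular: it is generated by the
-- N = (n choose 2) columns of an integer matrix V which is invertible over ℤ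
-- (the generators are linearly independent and form a basis of ℤ^N).
IsSimpleVertex : ℕ → (ℕ → ℕ) → Vect → Set
IsSimpleVertex n a x = IsVertex n a x
  × Σ IntMatrix (λ V → Σ IntMatrix (λ W →
      IsRightInverse n W V × IsRightInverse n V W
      × (∀ v → (InTangentCone n a x v ⇔
           Σ Vect (λ c → (∀ s → Valid n s → 0ℚ ℚ.≤ c s) × (v ≈[ n ] (V ·ᵥ c [ n ])))))))

IsPeak : List Pair → Pair → Set
IsPeak d (i , j) = ((i , j) ∈ d) × ((i , j ∸ 1) ∈ d) × ((suc i , j) ∈ d)

IsValley : List Pair → Pair → Set
IsValley d (i , j) = ((i , j) ∈ d) × ((i ∸ 1 , j) ∈ d) × ((i , suc j) ∈ d)

-- Suppose x_p = 0 at a peak or valley p of a tight path d.  Since V W = I,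
-- some generator v_k of the tangent cone at x has V_pk W_kp ≠ 0.  The lattice
-- points 0 and e_q (q ≠ p) of P_λ lie on the face {u_p = 0} through x, while
-- V_pk ≠ 0; this forces row k of W to be W_kp e_p.  Consequently, for any
-- linear f maximal at x, f(v_k) = 0 as soon as some point y of P_λ with
-- f y = f x has y_p ≠ 0.  For a tight path g such a y is the lattice point
-- that puts a_k on one cell of g in each row k and adds e_p, the extra unit
-- being absorbed in a row where g passes through a cell incomparable with p;
-- so S(v_k, g) = 0.  Replacing the corner p of d by the opposite corner p′
-- (or cutting d at the diagonal when p′ does not exist) yields tight paths
-- with S(v_k, ·) = 0, whence S(v_k, d) = V_pk > 0, although S(·, d) is
-- maximal at x and v_k points into P_λ.

module Submission where

open import Defs
open import Data.Nat as ℕ using (ℕ; zero; suc; _≤_; _<_; z≤n; s≤s; _∸_; _≤?_)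
import Data.Nat.Properties as ℕP
open import Data.Nat.Tactic.RingSolver using (solve-∀)
open import Data.Integer as ℤ using (ℤ)
import Data.Integer.Properties as ℤP
open import Data.Rational as ℚ using (ℚ; 0ℚ; 1ℚ; mkℚ; toℚᵘ; _+_; _*_; -_; _-_)
import Data.Rational.Properties as ℚP
import Data.Rational.Unnormalised as ℚᵘ
import Data.Rational.Unnormalised.Properties as ℚᵘP
import Data.Nat.Coprimality as Coprime
open import Data.List using (List; []; _∷_; _++_; map; foldr; last; [_]; applyUpTo; concatMap)
open import Data.Maybe using (just)
open import Data.List.Relation.Unary.Linked as Linked using (Linked; []; [-]; _∷_)
open import Data.List.Relation.Unary.Linked.Properties using (Linked⇒AllPairs)
open import Data.List.Relation.Unary.AllPairs as AllPairs using (AllPairs; []; _∷_)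
open import Data.Product using (_×_; _,_; Σ; proj₁; proj₂; ∃; ∃₂)
open import Data.Product.Properties using (≡-dec)
open import Data.Sum using (_⊎_; inj₁; inj₂)
open import Data.Empty using (⊥; ⊥-elim)
open import Data.List.Relation.Unary.All as All using (All; []; _∷_)
open import Data.List.Relation.Unary.Any using (here; there)
open import Data.List.Membership.Propositional using (_∈_)
open import Data.List.Membership.Propositional.Properties using (∈-++⁺ʳ)
import Data.List.Properties as ListP
import Data.List.Relation.Unary.All.Properties as AllP
import Data.Nat.ListAction.Properties as ListActionP
open import Function.Bundles using (_⇔_; Equivalence)
open import Function using (_∘_)
open import Relation.Nullary using (¬_; yes; no; Dec)
open import Relation.Binary.PropositionalEquality hiding ([_])
import Algebra.Solver.CommutativeMonoid ℚP.+-0-commutativeMonoid as ℚ+-Solver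
open ℚ+-Solver using (_⊕_; _⊜_)

-- Rational arithmetic

toℚ-mkℚ : ∀ z → toℚ z ≡ mkℚ z 0 (Coprime.sym (Coprime.1-coprimeTo _))
toℚ-mkℚ z = ℚP.↥p/↧p≡p (mkℚ z 0 (Coprime.sym (Coprime.1-coprimeTo _)))

toℚ-homo-+ : ∀ a b → toℚ (a ℤ.+ b) ≡ toℚ a + toℚ b
toℚ-homo-+ a b = ℚP.toℚᵘ-injective (begin
    toℚᵘ (toℚ (a ℤ.+ b))            ≡⟨ cong toℚᵘ (toℚ-mkℚ (a ℤ.+ b)) ⟩
    ℚᵘ.mkℚᵘ (a ℤ.+ b) 0              ≈⟨ ℚᵘ.*≡* cross ⟩
    toℚᵘ (toℚ a) ℚᵘ.+ toℚᵘ (toℚ b)  ≈⟨ ℚᵘP.≃-sym (ℚP.toℚᵘ-homo-+ (toℚ a) (toℚ b)) ⟩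
    toℚᵘ (toℚ a + toℚ b)            ∎)
  where
  open ℚᵘP.≃-Reasoning
  cross : (a ℤ.+ b) ℤ.* ℚᵘ.↧ (toℚᵘ (toℚ a) ℚᵘ.+ toℚᵘ (toℚ b)) ≡ ℚᵘ.↥ (toℚᵘ (toℚ a) ℚᵘ.+ toℚᵘ (toℚ b)) ℤ.* ℤ.+ 1
  cross rewrite toℚ-mkℚ a | toℚ-mkℚ b =
    cong₂ (λ u v → (u ℤ.+ v) ℤ.* ℤ.+ 1) (sym (ℤP.*-identityʳ a)) (sym (ℤP.*-identityʳ b))

toℚ-homo-* : ∀ a b → toℚ (a ℤ.* b) ≡ toℚ a * toℚ b
toℚ-homo-* a b = ℚP.toℚᵘ-injective (begin
    toℚᵘ (toℚ (a ℤ.* b))            ≡⟨ cong toℚᵘ (toℚ-mkℚ (a ℤ.* b)) ⟩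
    ℚᵘ.mkℚᵘ (a ℤ.* b) 0              ≈⟨ ℚᵘ.*≡* cross ⟩
    toℚᵘ (toℚ a) ℚᵘ.* toℚᵘ (toℚ b)  ≈⟨ ℚᵘP.≃-sym (ℚP.toℚᵘ-homo-* (toℚ a) (toℚ b)) ⟩
    toℚᵘ (toℚ a * toℚ b)            ∎)
  where
  open ℚᵘP.≃-Reasoning
  cross : (a ℤ.* b) ℤ.* ℚᵘ.↧ (toℚᵘ (toℚ a) ℚᵘ.* toℚᵘ (toℚ b)) ≡ ℚᵘ.↥ (toℚᵘ (toℚ a) ℚᵘ.* toℚᵘ (toℚ b)) ℤ.* ℤ.+ 1
  cross rewrite toℚ-mkℚ a | toℚ-mkℚ b = refl

toℚ≡0⇒≡0 : ∀ z → toℚ z ≡ 0ℚ → z ≡ ℤ.+ 0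
toℚ≡0⇒≡0 z eq = trans (sym (cong ℚ.↥_ (toℚ-mkℚ z))) (cong ℚ.↥_ eq)

fromℕ : ℕ → ℚ
fromℕ m = toℚ (ℤ.+ m)

fromℕ-homo-+ : ∀ m k → fromℕ (m ℕ.+ k) ≡ fromℕ m + fromℕ k
fromℕ-homo-+ m k = toℚ-homo-+ (ℤ.+ m) (ℤ.+ k)

fromℕ-mono-≤ : ∀ {m k} → m ≤ k → fromℕ m ℚ.≤ fromℕ k
fromℕ-mono-≤ {m} {k} m≤k rewrite toℚ-mkℚ (ℤ.+ m) | toℚ-mkℚ (ℤ.+ k) =
  ℚ.*≤* (ℤP.*-monoʳ-≤-nonNeg (ℤ.+ 1) (ℤ.+≤+ m≤k))

fromℕ-nonNeg : ∀ m → 0ℚ ℚ.≤ fromℕ m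
fromℕ-nonNeg m = fromℕ-mono-≤ {0} {m} z≤n

fromℕ≡0⇒≡0 : ∀ m → fromℕ m ≡ 0ℚ → m ≡ 0
fromℕ≡0⇒≡0 m eq = ℤP.+-injective (toℚ≡0⇒≡0 (ℤ.+ m) eq)

+-cancelˡ-≤ : ∀ a {b c} → a + b ℚ.≤ a + c → b ℚ.≤ c
+-cancelˡ-≤ a {b} {c} le = subst₂ ℚ._≤_ (cancel a b) (cancel a c) (ℚP.+-monoʳ-≤ (- a) le)
  where
  cancel : ∀ a z → - a + (a + z) ≡ z
  cancel a z = trans (sym (ℚP.+-assoc (- a) a z)) (trans (cong (_+ z) (ℚP.+-inverseˡ a)) (ℚP.+-identityˡ z))

+-tightˡ : ∀ {a b A B} → a ℚ.≤ A → b ℚ.≤ B → a + b ≡ A + B → a ≡ A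
+-tightˡ {a} {b} {A} {B} a≤A b≤B eq = ℚP.≤-antisym a≤A (+-cancelˡ-≤ b
  (subst₂ ℚ._≤_ (ℚP.+-comm A b) (trans (sym eq) (ℚP.+-comm a b)) (ℚP.+-monoʳ-≤ A b≤B)))

x-y≡0⇒x≡y : ∀ {x y} → x - y ≡ 0ℚ → x ≡ y
x-y≡0⇒x≡y {x} {y} eq = begin
  x             ≡⟨ ℚP.+-identityʳ x ⟨
  x + 0ℚ        ≡⟨ cong (x +_) (ℚP.+-inverseˡ y) ⟨
  x + (- y + y) ≡⟨ ℚP.+-assoc x (- y) y ⟨
  (x - y) + y   ≡⟨ cong (_+ y) eq ⟩
  0ℚ + y        ≡⟨ ℚP.+-identityˡ y ⟩
  y             ∎
  where open ≡-Reasoning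

x*y≡0⇒x≡0 : ∀ x y → x * y ≡ 0ℚ → ¬ y ≡ 0ℚ → x ≡ 0ℚ
x*y≡0⇒x≡0 x y eq y≢0 = begin
  x                  ≡⟨ sym (ℚP.*-identityʳ x) ⟩
  x * 1ℚ             ≡⟨ cong (x *_) (sym (ℚP.*-inverseʳ y)) ⟩
  x * (y * ℚ.1/ y)   ≡⟨ sym (ℚP.*-assoc x y _) ⟩
  (x * y) * ℚ.1/ y   ≡⟨ cong (_* ℚ.1/ y) eq ⟩
  0ℚ * ℚ.1/ y        ≡⟨ ℚP.*-zeroˡ (ℚ.1/ y) ⟩
  0ℚ                 ∎
  where
  open ≡-Reasoning
  instance _ = ℚ.≢-nonZero y≢0

x+1*[y-x]≡y : ∀ x y → x + 1ℚ * (y - x) ≡ y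
x+1*[y-x]≡y x y = begin
  x + 1ℚ * (y - x)   ≡⟨ cong (x +_) (ℚP.*-identityˡ (y - x)) ⟩
  x + (y - x)        ≡⟨ ℚP.+-comm x (y - x) ⟩
  (y - x) + x        ≡⟨ ℚP.+-assoc y (- x) x ⟩
  y + (- x + x)      ≡⟨ cong (y +_) (ℚP.+-inverseˡ x) ⟩
  y + 0ℚ             ≡⟨ ℚP.+-identityʳ y ⟩
  y                  ∎
  where open ≡-Reasoning

nonPos*nonNeg≤0 : ∀ {x y} → x ℚ.≤ 0ℚ → 0ℚ ℚ.≤ y → x * y ℚ.≤ 0ℚ
nonPos*nonNeg≤0 {x} {y} x≤0 0≤y =
  subst (x * y ℚ.≤_) (ℚP.*-zeroˡ y) (ℚP.*-monoʳ-≤-nonNeg y {{ℚ.nonNegative 0≤y}} x≤0)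

sumℚ-++ : ∀ xs ys → sumℚ (xs ++ ys) ≡ sumℚ xs + sumℚ ys
sumℚ-++ []       ys = sym (ℚP.+-identityˡ (sumℚ ys))
sumℚ-++ (x ∷ xs) ys = trans (cong (x +_) (sumℚ-++ xs ys)) (sym (ℚP.+-assoc x (sumℚ xs) (sumℚ ys)))

module _ {A : Set} where

  sumℚ-+ : ∀ (u w : A → ℚ) L → sumℚ (map (λ r → u r + w r) L) ≡ sumℚ (map u L) + sumℚ (map w L)
  sumℚ-+ u w []      = refl
  sumℚ-+ u w (r ∷ L) = trans (cong (u r + w r +_) (sumℚ-+ u w L)) (interchange (u r) (w r) _ _)
    where
    interchange : ∀ a b c d → (a + b) + (c + d) ≡ (a + c) + (b + d)
    interchange = ℚ+-Solver.solve 4 (λ a b c d → (a ⊕ b) ⊕ (c ⊕ d) ⊜ (a ⊕ c) ⊕ (b ⊕ d)) refl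

  sumℚ-*ʳ : ∀ (u : A → ℚ) c L → sumℚ (map (λ r → u r * c) L) ≡ sumℚ (map u L) * c
  sumℚ-*ʳ u c []      = sym (ℚP.*-zeroˡ c)
  sumℚ-*ʳ u c (r ∷ L) = trans (cong (u r * c +_) (sumℚ-*ʳ u c L)) (sym (ℚP.*-distribʳ-+ c (u r) _))

  sumℚ-cong : ∀ {P : A → Set} (u w : A → ℚ) {L} → All P L → (∀ r → P r → u r ≡ w r) →
              sumℚ (map u L) ≡ sumℚ (map w L)
  sumℚ-cong u w []         u≡w = refl
  sumℚ-cong u w (pr ∷ prs) u≡w = cong₂ _+_ (u≡w _ pr) (sumℚ-cong u w prs u≡w)

  sumℚ-zero : ∀ (u : A → ℚ) L → (∀ r → r ∈ L → u r ≡ 0ℚ) → sumℚ (map u L) ≡ 0ℚ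
  sumℚ-zero u []      _   = refl
  sumℚ-zero u (r ∷ L) u≡0 =
    trans (cong₂ _+_ (u≡0 r (here refl)) (sumℚ-zero u L (λ r′ m → u≡0 r′ (there m)))) (ℚP.+-identityʳ 0ℚ)

  sumℚ-nonPos : ∀ (u : A → ℚ) L → (∀ r → r ∈ L → u r ℚ.≤ 0ℚ) → sumℚ (map u L) ℚ.≤ 0ℚ
  sumℚ-nonPos u []      _   = ℚP.≤-refl
  sumℚ-nonPos u (r ∷ L) u≤0 = subst (u r + sumℚ (map u L) ℚ.≤_) (ℚP.+-identityʳ 0ℚ)
    (ℚP.+-mono-≤ (u≤0 r (here refl)) (sumℚ-nonPos u L (λ r′ m → u≤0 r′ (there m))))

  sumℚ-nonPos-≡0 : ∀ (u : A → ℚ) L → (∀ r → r ∈ L → u r ℚ.≤ 0ℚ) → sumℚ (map u L) ≡ 0ℚ →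
                   ∀ r → r ∈ L → u r ≡ 0ℚ
  sumℚ-nonPos-≡0 u (r ∷ L) u≤0 eq .r (here refl) =
    +-tightˡ (u≤0 r (here refl)) (sumℚ-nonPos u L (λ r′ m → u≤0 r′ (there m))) (trans eq (sym (ℚP.+-identityʳ 0ℚ)))
  sumℚ-nonPos-≡0 u (r ∷ L) u≤0 eq r′ (there m) = sumℚ-nonPos-≡0 u L (λ r″ m′ → u≤0 r″ (there m′)) rest r′ m
    where
    rest : sumℚ (map u L) ≡ 0ℚ
    rest = +-tightˡ (sumℚ-nonPos u L (λ r″ m′ → u≤0 r″ (there m′))) (u≤0 r (here refl))
      (trans (ℚP.+-comm _ (u r)) (trans eq (sym (ℚP.+-identityʳ 0ℚ))))

  toℚ-sum : ∀ (h : A → ℤ) L → toℚ (foldr ℤ._+_ (ℤ.+ 0) (map h L)) ≡ sumℚ (map (λ r → toℚ (h r)) L)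
  toℚ-sum h []      = refl
  toℚ-sum h (r ∷ L) = trans (toℚ-homo-+ (h r) _) (cong (toℚ (h r) +_) (toℚ-sum h L))

S-++ : ∀ v xs ys → S v (xs ++ ys) ≡ S v xs + S v ys
S-++ v xs ys = trans (cong sumℚ (ListP.map-++ v xs ys)) (sumℚ-++ (map v xs) (map v ys))

-- Finite sums and interval indicators

Σ< : ℕ → (ℕ → ℕ) → ℕ
Σ< zero    f = 0
Σ< (suc m) f = f 0 ℕ.+ Σ< m (λ t → f (suc t))

Σ<-cong : ∀ m {f g} → (∀ t → t < m → f t ≡ g t) → Σ< m f ≡ Σ< m g
Σ<-cong zero    f≡g = refl
Σ<-cong (suc m) f≡g = cong₂ ℕ._+_ (f≡g 0 (s≤s z≤n)) (Σ<-cong m (λ t t<m → f≡g (suc t) (s≤s t<m)))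

Σ<-mono-≤ : ∀ m {f g} → (∀ t → t < m → f t ≤ g t) → Σ< m f ≤ Σ< m g
Σ<-mono-≤ zero    f≤g = z≤n
Σ<-mono-≤ (suc m) f≤g = ℕP.+-mono-≤ (f≤g 0 (s≤s z≤n)) (Σ<-mono-≤ m (λ t t<m → f≤g (suc t) (s≤s t<m)))

Σ<-zero : ∀ m {f} → (∀ t → t < m → f t ≡ 0) → Σ< m f ≡ 0
Σ<-zero zero    f≡0 = refl
Σ<-zero (suc m) f≡0 = cong₂ ℕ._+_ (f≡0 0 (s≤s z≤n)) (Σ<-zero m (λ t t<m → f≡0 (suc t) (s≤s t<m)))

Σ<-+ : ∀ m f g → Σ< m (λ t → f t ℕ.+ g t) ≡ Σ< m f ℕ.+ Σ< m g
Σ<-+ zero    f g = refl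
Σ<-+ (suc m) f g = trans (cong (f 0 ℕ.+ g 0 ℕ.+_) (Σ<-+ m (λ t → f (suc t)) (λ t → g (suc t))))
  (interchange (f 0) (g 0) _ _)
  where
  interchange : ∀ a b c d → (a ℕ.+ b) ℕ.+ (c ℕ.+ d) ≡ (a ℕ.+ c) ℕ.+ (b ℕ.+ d)
  interchange = solve-∀

Σ<-split : ∀ m k f → Σ< (m ℕ.+ k) f ≡ Σ< m f ℕ.+ Σ< k (λ t → f (m ℕ.+ t))
Σ<-split zero    k f = refl
Σ<-split (suc m) k f = trans (cong (f 0 ℕ.+_) (Σ<-split m k (λ t → f (suc t)))) (sym (ℕP.+-assoc (f 0) _ _))

Σ<-single : ∀ m f v → v < m → (∀ t → t < m → ¬ t ≡ v → f t ≡ 0) → Σ< m f ≡ f v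
Σ<-single (suc m) f zero    _          f≡0 =
  trans (cong (f 0 ℕ.+_) (Σ<-zero m (λ t t<m → f≡0 (suc t) (s≤s t<m) λ ()))) (ℕP.+-identityʳ (f 0))
Σ<-single (suc m) f (suc v) (s≤s v<m) f≡0 = trans (cong (ℕ._+ Σ< m (λ t → f (suc t))) (f≡0 0 (s≤s z≤n) λ ()))
  (Σ<-single m (λ t → f (suc t)) v v<m (λ t t<m t≢v → f≡0 (suc t) (s≤s t<m) (t≢v ∘ ℕP.suc-injective)))

≤-Σ< : ∀ m f t → t < m → f t ≤ Σ< m f
≤-Σ< (suc m) f zero    _         = ℕP.m≤m+n (f 0) _
≤-Σ< (suc m) f (suc t) (s≤s t<m) = ℕP.≤-trans (≤-Σ< m (λ t → f (suc t)) t t<m) (ℕP.m≤n+m _ (f 0))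

sumℕ-applyUpTo : ∀ (h f : ℕ → ℕ) m → sumℕ (map h (applyUpTo f m)) ≡ Σ< m (λ t → h (f t))
sumℕ-applyUpTo h f zero    = refl
sumℕ-applyUpTo h f (suc m) = cong (h (f 0) ℕ.+_) (sumℕ-applyUpTo h (λ t → f (suc t)) m)

sumℕ-Σ< : ∀ {A : Set} m (F : ℕ → A → ℕ) (e : List A) →
          sumℕ (map (λ c → Σ< m (λ k → F k c)) e) ≡ Σ< m (λ k → sumℕ (map (F k) e))
sumℕ-Σ< m F []      = sym (Σ<-zero m (λ _ _ → refl))
sumℕ-Σ< m F (c ∷ e) = trans (cong (Σ< m (λ k → F k c) ℕ.+_) (sumℕ-Σ< m F e))
  (sym (Σ<-+ m (λ k → F k c) (λ k → sumℕ (map (F k) e))))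

sumℕ-linear : ∀ {A : Set} α β (f g : A → ℕ) e →
              sumℕ (map (λ c → α ℕ.* f c ℕ.+ β ℕ.* g c) e) ≡ α ℕ.* sumℕ (map f e) ℕ.+ β ℕ.* sumℕ (map g e)
sumℕ-linear α β f g []      = sym (cong₂ ℕ._+_ (ℕP.*-zeroʳ α) (ℕP.*-zeroʳ β))
sumℕ-linear α β f g (c ∷ e) = trans (cong (α ℕ.* f c ℕ.+ β ℕ.* g c ℕ.+_) (sumℕ-linear α β f g e)) (regroup α β (f c) (g c) _ _)
  where
  regroup : ∀ α β x y u v → (α ℕ.* x ℕ.+ β ℕ.* y) ℕ.+ (α ℕ.* u ℕ.+ β ℕ.* v) ≡ α ℕ.* (x ℕ.+ u) ℕ.+ β ℕ.* (y ℕ.+ v)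
  regroup = solve-∀

-- Abstract, so that a `with` on `_≤?_` in a goal mentioning χ does not unfold it.
abstract
  χ : ℕ → ℕ → ℕ → ℕ
  χ lo hi k with lo ≤? k | k ≤? hi
  ... | yes _ | yes _ = 1
  ... | _     | _     = 0

  χ≡1 : ∀ {lo hi k} → lo ≤ k → k ≤ hi → χ lo hi k ≡ 1
  χ≡1 {lo} {hi} {k} lo≤k k≤hi with lo ≤? k | k ≤? hi
  ... | yes _    | yes _    = refl
  ... | no lo≰k  | _        = ⊥-elim (lo≰k lo≤k)
  ... | yes _    | no k≰hi  = ⊥-elim (k≰hi k≤hi)

  χ≡0ˡ : ∀ {lo hi k} → k < lo → χ lo hi k ≡ 0
  χ≡0ˡ {lo} {hi} {k} k<lo with lo ≤? k | k ≤? hi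
  ... | yes lo≤k | yes _ = ⊥-elim (ℕP.<⇒≱ k<lo lo≤k)
  ... | no _     | _     = refl
  ... | yes _    | no _  = refl

  χ≡0ʳ : ∀ {lo hi k} → hi < k → χ lo hi k ≡ 0
  χ≡0ʳ {lo} {hi} {k} hi<k with lo ≤? k | k ≤? hi
  ... | yes _ | yes k≤hi = ⊥-elim (ℕP.<⇒≱ hi<k k≤hi)
  ... | no _  | _        = refl
  ... | yes _ | no _     = refl

  χ-cases : ∀ lo hi k → χ lo hi k ≡ 0 ⊎ (χ lo hi k ≡ 1 × lo ≤ k × k ≤ hi)
  χ-cases lo hi k with lo ≤? k | k ≤? hi
  ... | yes lo≤k | yes k≤hi = inj₂ (refl , lo≤k , k≤hi)
  ... | no _     | _        = inj₁ refl
  ... | yes _    | no _     = inj₁ refl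

χ-point≡0 : ∀ {v k} → ¬ k ≡ v → χ v v k ≡ 0
χ-point≡0 {v} {k} k≢v with χ-cases v v k
... | inj₁ χ≡0               = χ≡0
... | inj₂ (_ , v≤k , k≤v)   = ⊥-elim (k≢v (ℕP.≤-antisym k≤v v≤k))

χ-split : ∀ lo i hi k → lo ≤ suc i → i ≤ hi → χ lo hi k ≡ χ lo i k ℕ.+ χ (suc i) hi k
χ-split lo i hi k lo≤1+i i≤hi with lo ≤? k | k ≤? i | k ≤? hi
... | no lo≰k  | _       | _       = let k<lo = ℕP.≰⇒> lo≰k in
  trans (χ≡0ˡ {hi = hi} k<lo) (sym (cong₂ ℕ._+_ (χ≡0ˡ {hi = i} k<lo) (χ≡0ˡ {hi = hi} (ℕP.<-≤-trans k<lo lo≤1+i))))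
... | yes lo≤k | yes k≤i | _       =
  trans (χ≡1 lo≤k (ℕP.≤-trans k≤i i≤hi)) (sym (cong₂ ℕ._+_ (χ≡1 lo≤k k≤i) (χ≡0ˡ {hi = hi} (s≤s k≤i))))
... | yes lo≤k | no k≰i  | yes k≤hi =
  trans (χ≡1 lo≤k k≤hi) (sym (cong₂ ℕ._+_ (χ≡0ʳ {lo} (ℕP.≰⇒> k≰i)) (χ≡1 (ℕP.≰⇒> k≰i) k≤hi)))
... | yes _    | no k≰i  | no k≰hi =
  trans (χ≡0ʳ {lo} (ℕP.≰⇒> k≰hi)) (sym (cong₂ ℕ._+_ (χ≡0ʳ {lo} (ℕP.≰⇒> k≰i)) (χ≡0ʳ {suc i} (ℕP.≰⇒> k≰hi))))

Mℕ : (ℕ → ℕ) → ℕ → ℕ → ℕ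
Mℕ a lo hi = sumℕ (map a (range lo hi))

Mℕ-Σ< : ∀ a N lo hi → lo ≤ suc hi → hi < N → Mℕ a lo hi ≡ Σ< N (λ k → χ lo hi k ℕ.* a k)
Mℕ-Σ< a N lo hi lo≤1+hi hi<N = begin
    Mℕ a lo hi
  ≡⟨ sumℕ-applyUpTo a (lo ℕ.+_) len ⟩
    Σ< len (λ t → a (lo ℕ.+ t))
  ≡⟨ Σ<-cong len (λ t t<len → sym (trans (cong (ℕ._* a (lo ℕ.+ t)) (χ≡1 (ℕP.m≤m+n lo t) (inside t t<len))) (ℕP.*-identityˡ _))) ⟩
    Σ< len (λ t → g (lo ℕ.+ t))
  ≡⟨ sym (ℕP.+-identityʳ _) ⟩
    Σ< len (λ t → g (lo ℕ.+ t)) ℕ.+ 0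
  ≡⟨ cong (Σ< len (λ t → g (lo ℕ.+ t)) ℕ.+_) (sym (Σ<-zero rest (λ t _ → cong (ℕ._* a (lo ℕ.+ (len ℕ.+ t))) (χ≡0ʳ {lo} (above t))))) ⟩
    Σ< len (λ t → g (lo ℕ.+ t)) ℕ.+ Σ< rest (λ t → g (lo ℕ.+ (len ℕ.+ t)))
  ≡⟨ sym (Σ<-split len rest (λ t → g (lo ℕ.+ t))) ⟩
    Σ< (len ℕ.+ rest) (λ t → g (lo ℕ.+ t))
  ≡⟨ cong (ℕ._+ Σ< (len ℕ.+ rest) (λ t → g (lo ℕ.+ t))) (sym (Σ<-zero lo (λ t t<lo → cong (ℕ._* a t) (χ≡0ˡ {hi = hi} t<lo)))) ⟩
    Σ< lo g ℕ.+ Σ< (len ℕ.+ rest) (λ t → g (lo ℕ.+ t))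
  ≡⟨ sym (Σ<-split lo (len ℕ.+ rest) g) ⟩
    Σ< (lo ℕ.+ (len ℕ.+ rest)) g
  ≡⟨ cong (λ m → Σ< m g) total ⟩
    Σ< N g ∎
  where
  open ≡-Reasoning
  g = λ k → χ lo hi k ℕ.* a k
  len = suc hi ∸ lo
  rest = N ∸ suc hi
  lo+len≡1+hi : lo ℕ.+ len ≡ suc hi
  lo+len≡1+hi = ℕP.m+[n∸m]≡n lo≤1+hi
  inside : ∀ t → t < len → lo ℕ.+ t ≤ hi
  inside t t<len = ℕP.≤-pred (subst (suc (lo ℕ.+ t) ≤_) lo+len≡1+hi
    (subst (_≤ lo ℕ.+ len) (ℕP.+-suc lo t) (ℕP.+-monoʳ-≤ lo t<len)))
  above : ∀ t → hi < lo ℕ.+ (len ℕ.+ t)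
  above t = subst (hi <_) (ℕP.+-assoc lo len t)
    (ℕP.≤-trans (ℕP.≤-reflexive (sym lo+len≡1+hi)) (ℕP.m≤m+n (lo ℕ.+ len) t))
  total : lo ℕ.+ (len ℕ.+ rest) ≡ N
  total = trans (sym (ℕP.+-assoc lo len rest)) (trans (cong (ℕ._+ rest) lo+len≡1+hi) (ℕP.m+[n∸m]≡n hi<N))

Mℕ-single : ∀ h lo hi v → lo ≤ suc hi → (∀ k → ¬ k ≡ v → h k ≡ 0) → Mℕ h lo hi ≡ χ lo hi v ℕ.* h v
Mℕ-single h lo hi v lo≤1+hi h≡0 = trans (Mℕ-Σ< h N lo hi lo≤1+hi (s≤s (ℕP.m≤n⊔m v hi)))
    (Σ<-single N (λ k → χ lo hi k ℕ.* h k) v (s≤s (ℕP.m≤m⊔n v hi))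
      (λ k _ k≢v → trans (cong (χ lo hi k ℕ.*_) (h≡0 k k≢v)) (ℕP.*-zeroʳ (χ lo hi k))))
  where N = suc (v ℕ.⊔ hi)

Mℕ-split : ∀ a N lo i hi → lo ≤ i → i < hi → hi < N → Mℕ a lo hi ≡ Mℕ a lo i ℕ.+ Mℕ a (suc i) hi
Mℕ-split a N lo i hi lo≤i i<hi hi<N = begin
    Mℕ a lo hi
  ≡⟨ Mℕ-Σ< a N lo hi (ℕP.m≤n⇒m≤1+n (ℕP.≤-trans lo≤i (ℕP.<⇒≤ i<hi))) hi<N ⟩
    Σ< N (λ k → χ lo hi k ℕ.* a k)
  ≡⟨ Σ<-cong N (λ k _ → trans (cong (ℕ._* a k) (χ-split lo i hi k (ℕP.m≤n⇒m≤1+n lo≤i) (ℕP.<⇒≤ i<hi)))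
                               (ℕP.*-distribʳ-+ (a k) (χ lo i k) (χ (suc i) hi k))) ⟩
    Σ< N (λ k → χ lo i k ℕ.* a k ℕ.+ χ (suc i) hi k ℕ.* a k)
  ≡⟨ Σ<-+ N (λ k → χ lo i k ℕ.* a k) (λ k → χ (suc i) hi k ℕ.* a k) ⟩
    Σ< N (λ k → χ lo i k ℕ.* a k) ℕ.+ Σ< N (λ k → χ (suc i) hi k ℕ.* a k)
  ≡⟨ sym (cong₂ ℕ._+_ (Mℕ-Σ< a N lo i (ℕP.m≤n⇒m≤1+n lo≤i) (ℕP.<-trans i<hi hi<N))
                          (Mℕ-Σ< a N (suc i) hi (ℕP.m≤n⇒m≤1+n i<hi) hi<N)) ⟩
    Mℕ a lo i ℕ.+ Mℕ a (suc i) hi ∎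
  where open ≡-Reasoning

≤-Mℕ : ∀ a N lo hi → lo ≤ hi → hi < N → a lo ≤ Mℕ a lo hi
≤-Mℕ a N lo hi lo≤hi hi<N = subst (a lo ≤_) (sym (Mℕ-Σ< a N lo hi (ℕP.m≤n⇒m≤1+n lo≤hi) hi<N))
  (ℕP.≤-trans (ℕP.≤-reflexive (trans (sym (ℕP.*-identityˡ (a lo))) (cong (ℕ._* a lo) (sym (χ≡1 ℕP.≤-refl lo≤hi)))))
    (≤-Σ< N (λ k → χ lo hi k ℕ.* a k) lo (ℕP.≤-<-trans lo≤hi hi<N)))

-- Counting cells

infix 4 _≟ₚ_
_≟ₚ_ : (p q : Pair) → Dec (p ≡ q)
_≟ₚ_ = ≡-dec ℕ._≟_ ℕ._≟_

𝟙 : Pair → Pair → ℕ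
𝟙 q c with q ≟ₚ c
... | yes _ = 1
... | no  _ = 0

𝟙-self : ∀ q → 𝟙 q q ≡ 1
𝟙-self q with q ≟ₚ q
... | yes _   = refl
... | no q≢q  = ⊥-elim (q≢q refl)

𝟙-other : ∀ {q c} → ¬ q ≡ c → 𝟙 q c ≡ 0
𝟙-other {q} {c} q≢c with q ≟ₚ c
... | yes q≡c = ⊥-elim (q≢c q≡c)
... | no _    = refl

𝟙-pair : ∀ i₀ j₀ i j → 𝟙 (i₀ , j₀) (i , j) ≡ χ i₀ i₀ i ℕ.* χ j₀ j₀ j
𝟙-pair i₀ j₀ i j with (i₀ , j₀) ≟ₚ (i , j)
... | yes refl = sym (cong₂ ℕ._*_ (χ≡1 ℕP.≤-refl ℕP.≤-refl) (χ≡1 ℕP.≤-refl ℕP.≤-refl))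
... | no q≢c with i₀ ℕ.≟ i | j₀ ℕ.≟ j
...   | yes refl | yes refl = ⊥-elim (q≢c refl)
...   | no i₀≢i  | _        = sym (cong (ℕ._* χ j₀ j₀ j) (χ-point≡0 (i₀≢i ∘ sym)))
...   | yes refl | no j₀≢j  = sym (trans (cong (χ i₀ i₀ i₀ ℕ.*_) (χ-point≡0 (j₀≢j ∘ sym))) (ℕP.*-zeroʳ (χ i₀ i₀ i₀)))

occurrences : Pair → List Pair → ℕ
occurrences q e = sumℕ (map (𝟙 q) e)

occurrences-∉ : ∀ {q} e → ¬ q ∈ e → occurrences q e ≡ 0
occurrences-∉ []      _   = refl
occurrences-∉ (c ∷ e) q∉e = cong₂ ℕ._+_ (𝟙-other (q∉e ∘ here)) (occurrences-∉ e (q∉e ∘ there))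

∈⇒1≤occurrences : ∀ {q e} → q ∈ e → 1 ≤ occurrences q e
∈⇒1≤occurrences {q} {c ∷ e} (here refl) = subst (1 ≤_) (cong (ℕ._+ occurrences q e) (sym (𝟙-self q))) (s≤s z≤n)
∈⇒1≤occurrences {q} {c ∷ e} (there q∈e) = ℕP.≤-trans (∈⇒1≤occurrences q∈e) (ℕP.m≤n+m _ (𝟙 q c))

1≤occurrences⇒∈ : ∀ {q} e → 1 ≤ occurrences q e → q ∈ e
1≤occurrences⇒∈ {q} (c ∷ e) 1≤occ with q ≟ₚ c
... | yes refl = here refl
... | no _     = there (1≤occurrences⇒∈ e 1≤occ)

occurrences-concatMap : ∀ q (f : ℕ → List Pair) js →
                        occurrences q (concatMap f js) ≡ sumℕ (map (λ j → occurrences q (f j)) js)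
occurrences-concatMap q f []       = refl
occurrences-concatMap q f (j ∷ js) = trans
  (trans (cong sumℕ (ListP.map-++ (𝟙 q) (f j) (concatMap f js))) (ListActionP.sum-++ (map (𝟙 q) (f j)) _))
  (cong (occurrences q (f j) ℕ.+_) (occurrences-concatMap q f js))

occurrences-column : ∀ i₀ j₀ j is → occurrences (i₀ , j₀) (map (λ i → (i , j)) is) ≡ χ j₀ j₀ j ℕ.* sumℕ (map (χ i₀ i₀) is)
occurrences-column i₀ j₀ j []       = sym (ℕP.*-zeroʳ (χ j₀ j₀ j))
occurrences-column i₀ j₀ j (i ∷ is) =
  trans (cong₂ ℕ._+_ (trans (𝟙-pair i₀ j₀ i j) (ℕP.*-comm (χ i₀ i₀ i) (χ j₀ j₀ j))) (occurrences-column i₀ j₀ j is))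
        (sym (ℕP.*-distribˡ-+ (χ j₀ j₀ j) (χ i₀ i₀ i) _))

occurrences-pairs : ∀ n i₀ j₀ → 1 ≤ n → occurrences (i₀ , j₀) (pairs n) ≡ χ 2 n j₀ ℕ.* χ 1 (j₀ ∸ 1) i₀
occurrences-pairs n i₀ j₀ 1≤n = begin
    occurrences (i₀ , j₀) (pairs n)
  ≡⟨ occurrences-concatMap (i₀ , j₀) column (range 2 n) ⟩
    sumℕ (map (λ j → occurrences (i₀ , j₀) (column j)) (range 2 n))
  ≡⟨ cong sumℕ (ListP.map-cong (λ j → occurrences-column i₀ j₀ j (range 1 (j ∸ 1))) (range 2 n)) ⟩
    Mℕ (λ j → χ j₀ j₀ j ℕ.* Mℕ (χ i₀ i₀) 1 (j ∸ 1)) 2 n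
  ≡⟨ Mℕ-single _ 2 n j₀ (s≤s 1≤n) (λ j j≢j₀ → cong (ℕ._* _) (χ-point≡0 j≢j₀)) ⟩
    χ 2 n j₀ ℕ.* (χ j₀ j₀ j₀ ℕ.* Mℕ (χ i₀ i₀) 1 (j₀ ∸ 1))
  ≡⟨ cong (λ m → χ 2 n j₀ ℕ.* (m ℕ.* Mℕ (χ i₀ i₀) 1 (j₀ ∸ 1))) (χ≡1 ℕP.≤-refl ℕP.≤-refl) ⟩
    χ 2 n j₀ ℕ.* (1 ℕ.* Mℕ (χ i₀ i₀) 1 (j₀ ∸ 1))
  ≡⟨ cong (χ 2 n j₀ ℕ.*_) (ℕP.*-identityˡ _) ⟩
    χ 2 n j₀ ℕ.* Mℕ (χ i₀ i₀) 1 (j₀ ∸ 1)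
  ≡⟨ cong (χ 2 n j₀ ℕ.*_) (Mℕ-single (χ i₀ i₀) 1 (j₀ ∸ 1) i₀ (s≤s z≤n) (λ i → χ-point≡0)) ⟩
    χ 2 n j₀ ℕ.* (χ 1 (j₀ ∸ 1) i₀ ℕ.* χ i₀ i₀ i₀)
  ≡⟨ cong (λ m → χ 2 n j₀ ℕ.* (χ 1 (j₀ ∸ 1) i₀ ℕ.* m)) (χ≡1 ℕP.≤-refl ℕP.≤-refl) ⟩
    χ 2 n j₀ ℕ.* (χ 1 (j₀ ∸ 1) i₀ ℕ.* 1)
  ≡⟨ cong (χ 2 n j₀ ℕ.*_) (ℕP.*-identityʳ _) ⟩
    χ 2 n j₀ ℕ.* χ 1 (j₀ ∸ 1) i₀ ∎
  where
  open ≡-Reasoning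
  column : ℕ → List Pair
  column j = map (λ i → (i , j)) (range 1 (j ∸ 1))

occurrences-pairs-valid : ∀ n q → Valid n q → occurrences q (pairs n) ≡ 1
occurrences-pairs-valid n (i₀ , j₀) (1≤i₀ , i₀<j₀ , j₀≤n) =
  trans (occurrences-pairs n i₀ j₀ (ℕP.≤-trans 1≤i₀ (ℕP.≤-trans (ℕP.<⇒≤ i₀<j₀) j₀≤n)))
        (cong₂ ℕ._*_ (χ≡1 (ℕP.≤-trans (s≤s 1≤i₀) i₀<j₀) j₀≤n) (χ≡1 1≤i₀ i₀≤j₀-1))
  where
  i₀≤j₀-1 : i₀ ≤ j₀ ∸ 1
  i₀≤j₀-1 = ℕP.∸-monoˡ-≤ 1 i₀<j₀

∈pairs⇒counted : ∀ n {i₀ j₀} → (i₀ , j₀) ∈ pairs (suc n) → ¬ χ 2 (suc n) j₀ ℕ.* χ 1 (j₀ ∸ 1) i₀ ≡ 0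
∈pairs⇒counted n {i₀} {j₀} q∈ eq =
  ℕP.n≮0 (subst (1 ≤_) (trans (occurrences-pairs (suc n) i₀ j₀ (s≤s z≤n)) eq) (∈⇒1≤occurrences q∈))

∈pairs⇒Valid : ∀ n {q} → q ∈ pairs n → Valid n q
∈pairs⇒Valid (suc n) {i₀ , j₀} q∈ with χ-cases 2 (suc n) j₀ | χ-cases 1 (j₀ ∸ 1) i₀
... | inj₂ (_ , 2≤j₀ , j₀≤n) | inj₂ (_ , 1≤i₀ , i₀≤j₀-1) =
  1≤i₀ , subst (suc i₀ ≤_) (ℕP.m+[n∸m]≡n (ℕP.≤-trans (s≤s z≤n) 2≤j₀)) (s≤s i₀≤j₀-1) , j₀≤n
... | inj₁ χ≡0 | _        = ⊥-elim (∈pairs⇒counted n q∈ (cong (ℕ._* χ 1 (j₀ ∸ 1) i₀) χ≡0))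
... | inj₂ _   | inj₁ χ≡0 =
  ⊥-elim (∈pairs⇒counted n q∈ (trans (cong (χ 2 (suc n) j₀ ℕ.*_) χ≡0) (ℕP.*-zeroʳ (χ 2 (suc n) j₀))))

Valid⇒∈pairs : ∀ n {q} → Valid n q → q ∈ pairs n
Valid⇒∈pairs n {q} valid = 1≤occurrences⇒∈ (pairs n) (ℕP.≤-reflexive (sym (occurrences-pairs-valid n q valid)))

pairs-valid : ∀ n → All (Valid n) (pairs n)
pairs-valid n = All.tabulate (∈pairs⇒Valid n)

sumℚ-single : ∀ (u : Pair → ℚ) q L → (∀ r → r ∈ L → ¬ r ≡ q → u r ≡ 0ℚ) → occurrences q L ≡ 1 →
              sumℚ (map u L) ≡ u q
sumℚ-single u q (r ∷ L) u≡0 once with q ≟ₚ r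
... | yes refl = trans (cong (u q +_) (sumℚ-zero u L (λ r′ m → u≡0 r′ (there m) (λ { refl → q∉L m })))) (ℚP.+-identityʳ (u q))
  where
  q∉L : ¬ q ∈ L
  q∉L q∈L = ℕP.<-irrefl refl (ℕP.≤-trans (s≤s (∈⇒1≤occurrences q∈L)) (ℕP.≤-reflexive once))
... | no q≢r = trans (cong (_+ sumℚ (map u L)) (u≡0 r (here refl) (q≢r ∘ sym)))
  (trans (ℚP.+-identityˡ _) (sumℚ-single u q L (λ r′ m → u≡0 r′ (there m)) once))

-- Dyck paths

infix 4 _⊑_ _≺_

_⊑_ : Pair → Pair → Set
p ⊑ q = proj₁ p ≤ proj₁ q × proj₂ p ≤ proj₂ q

⊑-refl : ∀ {p} → p ⊑ p
⊑-refl = ℕP.≤-refl , ℕP.≤-refl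

⊑-trans : ∀ {p q r} → p ⊑ q → q ⊑ r → p ⊑ r
⊑-trans (i≤ , j≤) (i≤′ , j≤′) = ℕP.≤-trans i≤ i≤′ , ℕP.≤-trans j≤ j≤′

rank : Pair → ℕ
rank (i , j) = i ℕ.+ j

⊑∧rank≡⇒≡ : ∀ {p q} → p ⊑ q → rank p ≡ rank q → p ≡ q
⊑∧rank≡⇒≡ {i , j} {i′ , j′} (i≤i′ , j≤j′) eq with ℕP.m≤n⇒m<n∨m≡n i≤i′
... | inj₁ i<i′ = ⊥-elim (ℕP.<-irrefl eq (ℕP.+-mono-<-≤ i<i′ j≤j′))
... | inj₂ refl = cong (i ,_) (ℕP.+-cancelˡ-≡ i j j′ eq)

_≺_ : Pair → Pair → Set
p ≺ q = p ⊑ q × rank p < rank q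

≺-trans : ∀ {p q r} → p ≺ q → q ≺ r → p ≺ r
≺-trans (p⊑q , p<q) (q⊑r , q<r) = ⊑-trans p⊑q q⊑r , ℕP.<-trans p<q q<r

≺-irrefl : ∀ {p} → ¬ p ≺ p
≺-irrefl (_ , p<p) = ℕP.<-irrefl refl p<p

Step⇒⊑ : ∀ {u v} → Step u v → u ⊑ v
Step⇒⊑ (inj₁ (refl , refl)) = ℕP.n≤1+n _ , ℕP.≤-refl
Step⇒⊑ (inj₂ (refl , refl)) = ℕP.≤-refl , ℕP.n≤1+n _

Step⇒rank : ∀ {u v} → Step u v → rank v ≡ suc (rank u)
Step⇒rank {i , j} (inj₁ (refl , refl)) = refl
Step⇒rank {i , j} (inj₂ (refl , refl)) = ℕP.+-suc i j

Step⇒≺ : ∀ {u v} → Step u v → u ≺ v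
Step⇒≺ s = Step⇒⊑ s , ℕP.≤-reflexive (sym (Step⇒rank s))

Step-row : ∀ {u v} → Step u v → proj₁ v ≤ suc (proj₁ u)
Step-row (inj₁ (refl , refl)) = ℕP.≤-refl
Step-row (inj₂ (refl , refl)) = ℕP.n≤1+n _

path-ordered : ∀ {e} → Linked Step e → AllPairs _≺_ e
path-ordered l = Linked⇒AllPairs ≺-trans (Linked.map Step⇒≺ l)

comparable : ∀ {e a b} → AllPairs _≺_ e → a ∈ e → b ∈ e → a ⊑ b ⊎ b ⊑ a
comparable _            (here refl) (here refl) = inj₁ ⊑-refl
comparable (a≺ ∷ _)     (here refl) (there b∈)  = inj₁ (proj₁ (All.lookup a≺ b∈))
comparable (b≺ ∷ _)     (there a∈)  (here refl) = inj₂ (proj₁ (All.lookup b≺ a∈))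
comparable (_ ∷ ordered) (there a∈) (there b∈)  = comparable ordered a∈ b∈

occurrences≤1 : ∀ {q e} → AllPairs _≺_ e → occurrences q e ≤ 1
occurrences≤1 {q} {[]}    []               = z≤n
occurrences≤1 {q} {c ∷ e} (c≺ ∷ ordered) with q ≟ₚ c
... | yes refl = ℕP.≤-reflexive (cong suc (occurrences-∉ e (λ q∈e → ≺-irrefl (All.lookup c≺ q∈e))))
... | no _     = occurrences≤1 ordered

last-∈ : ∀ {e : List Pair} {q} → last e ≡ just q → q ∈ e
last-∈ {h ∷ []}     refl = here refl
last-∈ {h ∷ h′ ∷ t} eq   = there (last-∈ {h′ ∷ t} eq)

lastRow-last : ∀ {e : List Pair} {q} → last e ≡ just q → lastRow e ≡ proj₁ q
lastRow-last {h ∷ []}     refl = refl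
lastRow-last {h ∷ h′ ∷ t} eq   = lastRow-last {h′ ∷ t} eq

⊑-last : ∀ {e q c} → Linked Step e → last e ≡ just q → c ∈ e → c ⊑ q
⊑-last {h ∷ []}     _       refl (here refl) = ⊑-refl
⊑-last {h ∷ h′ ∷ t} (s ∷ l) eq   (here refl) = ⊑-trans (Step⇒⊑ s) (⊑-last l eq (here refl))
⊑-last {h ∷ h′ ∷ t} (s ∷ l) eq   (there c∈)  = ⊑-last l eq c∈

firstRow-≤ : ∀ {e c} → AllPairs _≺_ e → c ∈ e → firstRow e ≤ proj₁ c
firstRow-≤ _        (here refl) = ℕP.≤-refl
firstRow-≤ (h≺ ∷ _) (there c∈)  = proj₁ (proj₁ (All.lookup h≺ c∈))

rows-occupied : ∀ {h t q k} → Linked Step (h ∷ t) → last (h ∷ t) ≡ just q →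
                proj₁ h ≤ k → k ≤ proj₁ q → ∃ λ j → (k , j) ∈ h ∷ t
rows-occupied {h} {[]}     _       refl h≤k k≤q = proj₂ h , here (cong (_, proj₂ h) (ℕP.≤-antisym k≤q h≤k))
rows-occupied {h} {h′ ∷ t} {k = k} (s ∷ l) eq h≤k k≤q with proj₁ h ℕ.≟ k
... | yes refl = proj₂ h , here refl
... | no h≢k   = let j , k∈ = rows-occupied l eq (ℕP.≤-trans (Step-row s) (ℕP.≤∧≢⇒< h≤k h≢k)) k≤q in j , there k∈

cellInRow : ℕ → List Pair → Pair
cellInRow k []      = 0 , 0
cellInRow k (c ∷ e) with proj₁ c ℕ.≟ k
... | yes _ = c
... | no  _ = cellInRow k e

cellInRow-∈ : ∀ {k j} e → (k , j) ∈ e → cellInRow k e ∈ e × proj₁ (cellInRow k e) ≡ k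
cellInRow-∈ {k} (c ∷ e) k∈ with proj₁ c ℕ.≟ k
cellInRow-∈ {k} (c ∷ e) _           | yes c₁≡k = here refl , c₁≡k
cellInRow-∈ {k} (c ∷ e) (here refl) | no c₁≢k  = ⊥-elim (c₁≢k refl)
cellInRow-∈ {k} (c ∷ e) (there k∈)  | no _     = let ∈e , row≡ = cellInRow-∈ e k∈ in there ∈e , row≡

Covers : Pair → ℕ → Set
Covers (i , j) k = i ≤ k × k < j

module DyckPath {n e} (D : IsDyck n e) where

  linked : Linked Step e
  linked = proj₁ (proj₂ D)

  ordered : AllPairs _≺_ e
  ordered = path-ordered linked

  valid : ∀ {c} → c ∈ e → Valid n c
  valid = All.lookup (proj₁ D)

  endRow : ℕ
  endRow = proj₁ (proj₂ (proj₂ (proj₂ D)))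

  ends : last e ≡ just (endRow , suc endRow)
  ends = proj₂ (proj₂ (proj₂ (proj₂ D)))

  lastRow≡endRow : lastRow e ≡ endRow
  lastRow≡endRow = lastRow-last {e} ends

  firstRow≤ : ∀ {c} → c ∈ e → firstRow e ≤ proj₁ c
  firstRow≤ = firstRow-≤ ordered

  ≤lastRow : ∀ {c} → c ∈ e → proj₁ c ≤ lastRow e
  ≤lastRow c∈ = subst (_ ≤_) (sym lastRow≡endRow) (proj₁ (⊑-last linked ends c∈))

  col≤ : ∀ {c} → c ∈ e → proj₂ c ≤ suc (lastRow e)
  col≤ c∈ = subst (λ r → _ ≤ suc r) (sym lastRow≡endRow) (proj₂ (⊑-last linked ends c∈))

  lastRow<n : suc (lastRow e) ≤ n
  lastRow<n = subst (λ r → suc r ≤ n) (sym lastRow≡endRow) (proj₂ (proj₂ (valid (last-∈ {e} ends))))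

  covers⇒inRows : ∀ {c k} → c ∈ e → Covers c k → firstRow e ≤ k × k ≤ lastRow e
  covers⇒inRows c∈ (c₁≤k , k<c₂) = ℕP.≤-trans (firstRow≤ c∈) c₁≤k , ℕP.≤-pred (ℕP.≤-trans k<c₂ (col≤ c∈))

  head∈ : Σ Pair (_∈ e)
  head∈ = head∈′ e (proj₁ (proj₂ (proj₂ D)))
    where
    head∈′ : ∀ e → StartsOnDiag e → Σ Pair (_∈ e)
    head∈′ (h ∷ _) _ = h , here refl

  firstRow≤lastRow : firstRow e ≤ lastRow e
  firstRow≤lastRow = let _ , h∈ = head∈ in ℕP.≤-trans (firstRow≤ h∈) (≤lastRow h∈)

  1≤firstRow : 1 ≤ firstRow e
  1≤firstRow = first e (proj₁ (proj₂ (proj₂ D))) (proj₁ D)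
    where
    first : ∀ e → StartsOnDiag e → All (Valid n) e → 1 ≤ firstRow e
    first (h ∷ _) _ (valid-h ∷ _) = proj₁ valid-h

  row-occupied : ∀ {k} → firstRow e ≤ k → k ≤ lastRow e → ∃ λ j → (k , j) ∈ e
  row-occupied {k} first≤k k≤last = occupied e linked ends first≤k (subst (k ≤_) lastRow≡endRow k≤last)
    where
    occupied : ∀ e′ → Linked Step e′ → last e′ ≡ just (endRow , suc endRow) → firstRow e′ ≤ k → k ≤ endRow →
               ∃ λ j → (k , j) ∈ e′
    occupied (h ∷ t) l eq = rows-occupied {h} {t} {k = k} l eq

occurrences-cases : ∀ q {e} → AllPairs _≺_ e → occurrences q e ≡ 0 ⊎ (occurrences q e ≡ 1 × q ∈ e)
occurrences-cases q {e} ordered with occurrences q e in eq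
... | zero        = inj₁ refl
... | suc zero    = inj₂ (refl , 1≤occurrences⇒∈ e (ℕP.≤-reflexive (sym eq)))
... | suc (suc m) = ⊥-elim (ℕP.<-irrefl refl (ℕP.≤-trans (s≤s (s≤s z≤n)) (subst (_≤ 1) eq (occurrences≤1 {q} ordered))))

-- Lattice points of P_λ

S-fromℕ : ∀ (b : Pair → ℕ) e → S (fromℕ ∘ b) e ≡ fromℕ (sumℕ (map b e))
S-fromℕ b []      = refl
S-fromℕ b (c ∷ e) = trans (cong (fromℕ (b c) +_) (S-fromℕ b e)) (sym (fromℕ-homo-+ (b c) _))

integer-point-∈P : ∀ n a (b : Pair → ℕ) → (∀ e → IsDyck n e → sumℕ (map b e) ≤ Mℕ a (firstRow e) (lastRow e)) →
                   InP n a (fromℕ ∘ b)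
integer-point-∈P n a b bounded =
  (λ q _ → fromℕ-nonNeg (b q)) , (λ e E → subst (ℚ._≤ M a e) (sym (S-fromℕ b e)) (fromℕ-mono-≤ (bounded e E)))

module TightPoint (n : ℕ) (a : ℕ → ℕ) {g} (G : IsDyck n g) (p : Pair) (k₀ : ℕ) (r : Pair)
  (1≤a : 1 ≤ a k₀) (p-covers : Covers p k₀) (p₂≤n : proj₂ p ≤ n)
  (witness : firstRow g ≤ k₀ → k₀ ≤ lastRow g → r ∈ g × Covers r k₀ × ¬ r ⊑ p × ¬ p ⊑ r) where

  private
    module G = DyckPath G
    N = suc n
    lo = firstRow g
    hi = lastRow g

  chosen : ℕ → Pair
  chosen k with k ℕ.≟ k₀
  ... | yes _ = r
  ... | no  _ = cellInRow k g

  chosen-k₀ : chosen k₀ ≡ r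
  chosen-k₀ with k₀ ℕ.≟ k₀
  ... | yes _     = refl
  ... | no k₀≢k₀  = ⊥-elim (k₀≢k₀ refl)

  chosen-covers : ∀ k → lo ≤ k → k ≤ hi → chosen k ∈ g × Covers (chosen k) k
  chosen-covers k lo≤k k≤hi with k ℕ.≟ k₀
  ... | yes refl = let r∈ , covers , _ = witness lo≤k k≤hi in r∈ , covers
  ... | no _     = c∈ , ℕP.≤-reflexive row≡ , subst (_< proj₂ (cellInRow k g)) row≡ (proj₁ (proj₂ (G.valid c∈)))
    where
    c∈ = proj₁ (cellInRow-∈ g (proj₂ (G.row-occupied lo≤k k≤hi)))
    row≡ = proj₂ (cellInRow-∈ g (proj₂ (G.row-occupied lo≤k k≤hi)))

  -- point = Σ_{k ∈ rows g} a_k e_(chosen k) + e_p, with e_p put into the k₀-th summand so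
  -- that path sums are bounded row by row: a path through p misses r, which is
  -- incomparable with p, so in row k₀ it collects 1 ≤ a_k₀ instead of a_k₀.
  contribution : ℕ → Pair → ℕ
  contribution k c = (χ lo hi k ℕ.* a k) ℕ.* 𝟙 (chosen k) c ℕ.+ χ k₀ k₀ k ℕ.* 𝟙 p c

  point : Pair → ℕ
  point c = Σ< N (λ k → contribution k c)

  point-sum : ∀ e → sumℕ (map point e) ≡
    Σ< N (λ k → (χ lo hi k ℕ.* a k) ℕ.* occurrences (chosen k) e ℕ.+ χ k₀ k₀ k ℕ.* occurrences p e)
  point-sum e = trans (sumℕ-Σ< N contribution e)
    (Σ<-cong N (λ k _ → sumℕ-linear (χ lo hi k ℕ.* a k) (χ k₀ k₀ k) (𝟙 (chosen k)) (𝟙 p) e))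

  module _ {e} (E : IsDyck n e) where

    private
      module E = DyckPath E
      χₑ = χ (firstRow e) (lastRow e)

    covered-row : ∀ {c k} → c ∈ e → Covers c k → χₑ k ≡ 1
    covered-row c∈e covers = let first≤k , k≤last = E.covers⇒inRows c∈e covers in χ≡1 first≤k k≤last

    chosen-term≤ : ∀ k → (χ lo hi k ℕ.* a k) ℕ.* occurrences (chosen k) e ≤ χₑ k ℕ.* a k
    chosen-term≤ k with χ-cases lo hi k
    ... | inj₁ χ≡0 rewrite χ≡0 = z≤n
    ... | inj₂ (χ≡1 , lo≤k , k≤hi) with occurrences-cases (chosen k) E.ordered
    ...   | inj₁ occ≡0 rewrite occ≡0 = subst (_≤ χₑ k ℕ.* a k) (sym (ℕP.*-zeroʳ (χ lo hi k ℕ.* a k))) z≤n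
    ...   | inj₂ (occ≡1 , c∈e) rewrite χ≡1 | occ≡1 | covered-row c∈e (proj₂ (chosen-covers k lo≤k k≤hi)) =
      ℕP.≤-reflexive (ℕP.*-identityʳ (1 ℕ.* a k))

    chosen-k₀-absent : p ∈ e → (χ lo hi k₀ ℕ.* a k₀) ℕ.* occurrences (chosen k₀) e ≡ 0
    chosen-k₀-absent p∈e with χ-cases lo hi k₀
    ... | inj₁ χ≡0 rewrite χ≡0 = refl
    ... | inj₂ (_ , lo≤k₀ , k₀≤hi) with occurrences-cases (chosen k₀) E.ordered
    ...   | inj₁ occ≡0 = trans (cong (χ lo hi k₀ ℕ.* a k₀ ℕ.*_) occ≡0) (ℕP.*-zeroʳ (χ lo hi k₀ ℕ.* a k₀))
    ...   | inj₂ (_ , c∈e) with comparable E.ordered (subst (_∈ e) chosen-k₀ c∈e) p∈e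
    ...     | inj₁ r⊑p = ⊥-elim (proj₁ (proj₂ (proj₂ (witness lo≤k₀ k₀≤hi))) r⊑p)
    ...     | inj₂ p⊑r = ⊥-elim (proj₂ (proj₂ (proj₂ (witness lo≤k₀ k₀≤hi))) p⊑r)

    term≤ : ∀ k → (χ lo hi k ℕ.* a k) ℕ.* occurrences (chosen k) e ℕ.+ χ k₀ k₀ k ℕ.* occurrences p e ≤ χₑ k ℕ.* a k
    term≤ k = by-cases (k ℕ.≟ k₀)
      where
      by-cases : Dec (k ≡ k₀) →
                 (χ lo hi k ℕ.* a k) ℕ.* occurrences (chosen k) e ℕ.+ χ k₀ k₀ k ℕ.* occurrences p e ≤ χₑ k ℕ.* a k
      by-cases (no k≢k₀) rewrite χ-point≡0 k≢k₀ = subst (_≤ χₑ k ℕ.* a k) (sym (ℕP.+-identityʳ _)) (chosen-term≤ k)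
      by-cases (yes refl) with occurrences-cases p E.ordered
      ... | inj₁ occ≡0 rewrite occ≡0 =
        subst (_≤ χₑ k₀ ℕ.* a k₀)
          (sym (trans (cong (chosen-term ℕ.+_) (ℕP.*-zeroʳ (χ k₀ k₀ k₀))) (ℕP.+-identityʳ chosen-term)))
          (chosen-term≤ k₀)
        where chosen-term = (χ lo hi k₀ ℕ.* a k₀) ℕ.* occurrences (chosen k₀) e
      ... | inj₂ (occ≡1 , p∈e) rewrite chosen-k₀-absent p∈e | occ≡1 | χ≡1 {k₀} {k₀} {k₀} ℕP.≤-refl ℕP.≤-refl
                                   | covered-row p∈e p-covers = ℕP.≤-trans 1≤a (ℕP.m≤m+n (a k₀) 0)

  point-bounded : ∀ e → IsDyck n e → sumℕ (map point e) ≤ Mℕ a (firstRow e) (lastRow e)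
  point-bounded e E = subst₂ _≤_ (sym (point-sum e))
    (sym (Mℕ-Σ< a N (firstRow e) (lastRow e) (ℕP.m≤n⇒m≤1+n E.firstRow≤lastRow) (ℕP.m≤n⇒m≤1+n E.lastRow<n)))
    (Σ<-mono-≤ N (λ k _ → term≤ E k))
    where module E = DyckPath E

  point-tight : Mℕ a lo hi ≤ sumℕ (map point g)
  point-tight = subst₂ _≤_ (sym (Mℕ-Σ< a N lo hi (ℕP.m≤n⇒m≤1+n G.firstRow≤lastRow) (ℕP.m≤n⇒m≤1+n G.lastRow<n)))
    (sym (point-sum g)) (Σ<-mono-≤ N (λ k _ → ≤term k))
    where
    ≤term : ∀ k → χ lo hi k ℕ.* a k ≤ (χ lo hi k ℕ.* a k) ℕ.* occurrences (chosen k) g ℕ.+ χ k₀ k₀ k ℕ.* occurrences p g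
    ≤term k with χ-cases lo hi k
    ... | inj₁ χ≡0 rewrite χ≡0 = z≤n
    ... | inj₂ (_ , lo≤k , k≤hi) = ℕP.≤-trans
      (ℕP.m≤m*n _ _ {{ℕ.>-nonZero (∈⇒1≤occurrences (proj₁ (chosen-covers k lo≤k k≤hi)))}}) (ℕP.m≤m+n _ _)

  1≤point-p : 1 ≤ point p
  1≤point-p = ℕP.≤-trans 1≤contribution (≤-Σ< N (λ k → contribution k p) k₀ (s≤s (ℕP.≤-trans (ℕP.<⇒≤ (proj₂ p-covers)) p₂≤n)))
    where
    1≤contribution : 1 ≤ contribution k₀ p
    1≤contribution rewrite χ≡1 {k₀} {k₀} {k₀} ℕP.≤-refl ℕP.≤-refl | 𝟙-self p = ℕP.m≤n+m 1 _

tight-integer-point : ∀ n a {g} → IsDyck n g → ∀ p k₀ r → 1 ≤ a k₀ → Covers p k₀ → proj₂ p ≤ n →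
  (firstRow g ≤ k₀ → k₀ ≤ lastRow g → r ∈ g × Covers r k₀ × ¬ r ⊑ p × ¬ p ⊑ r) →
  Σ (Pair → ℕ) λ b → InP n a (fromℕ ∘ b) × S (fromℕ ∘ b) g ≡ M a g × 1 ≤ b p
tight-integer-point n a {g} G p k₀ r 1≤a p-covers p₂≤n witness =
  point , y∈P , ℚP.≤-antisym (proj₂ y∈P g G) (subst (M a g ℚ.≤_) (sym (S-fromℕ point g)) (fromℕ-mono-≤ point-tight)) , 1≤point-p
  where
  open TightPoint n a G p k₀ r 1≤a p-covers p₂≤n witness
  y∈P = integer-point-∈P n a point point-bounded

-- Linear functionals and the tangent cone

InP-resp : ∀ {n a u w} → u ≈[ n ] w → InP n a u → InP n a w
InP-resp {n} {a} {u} {w} u≈w (nonNeg , bounded) =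
  (λ q valid → subst (0ℚ ℚ.≤_) (u≈w q valid) (nonNeg q valid)) ,
  (λ d D → subst (ℚ._≤ M a d) (sumℚ-cong u w (proj₁ D) u≈w) (bounded d D))

record Linear (n : ℕ) (f : Vect → ℚ) : Set where
  field
    additive    : ∀ u w → f (λ r → u r + w r) ≡ f u + f w
    homogeneous : ∀ u c → f (λ r → u r * c) ≡ f u * c
    respects    : ∀ u w → u ≈[ n ] w → f u ≡ f w

  preserves-0 : f (λ _ → 0ℚ) ≡ 0ℚ
  preserves-0 = trans (respects _ _ (λ r _ → sym (ℚP.*-zeroʳ 0ℚ))) (trans (homogeneous (λ _ → 0ℚ) 0ℚ) (ℚP.*-zeroʳ (f (λ _ → 0ℚ))))

  sub : ∀ u w → f (λ r → u r - w r) ≡ f u - f w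
  sub u w = begin
    f (λ r → u r - w r)            ≡⟨ additive u (λ r → - w r) ⟩
    f u + f (λ r → - w r)          ≡⟨ cong (f u +_) (respects _ _ (λ r _ → negate (w r))) ⟩
    f u + f (λ r → w r * - 1ℚ)     ≡⟨ cong (f u +_) (homogeneous w (- 1ℚ)) ⟩
    f u + f w * - 1ℚ               ≡⟨ sym (cong (f u +_) (negate (f w))) ⟩
    f u - f w                      ∎
    where
    open ≡-Reasoning
    negate : ∀ z → - z ≡ z * - 1ℚ
    negate z = trans (cong -_ (sym (ℚP.*-identityʳ z))) (ℚP.neg-distribʳ-* z 1ℚ)

  shift : ∀ x v t → f (λ r → x r + t * v r) ≡ f x + f v * t
  shift x v t = trans (additive x (λ r → t * v r))
    (cong (f x +_) (trans (respects _ _ (λ r _ → ℚP.*-comm t (v r))) (homogeneous v t)))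

column : IntMatrix → Pair → Vect
column V m r = toℚ (V r m)

combination : IntMatrix → Vect → List Pair → Vect
combination V c L r = sumℚ (map (λ s → toℚ (V r s) * c s) L)

Linear-combination : ∀ {n f} → Linear n f → ∀ V c L → f (combination V c L) ≡ sumℚ (map (λ m → f (column V m) * c m) L)
Linear-combination F V c []      = Linear.preserves-0 F
Linear-combination F V c (m ∷ L) = trans (Linear.additive F (λ r → toℚ (V r m) * c m) (combination V c L))
  (cong₂ _+_ (Linear.homogeneous F (column V m) (c m)) (Linear-combination F V c L))

S-linear : ∀ {n} g → All (Valid n) g → Linear n (λ u → S u g)
S-linear g valid = record
  { additive    = λ u w → sumℚ-+ u w g
  ; homogeneous = λ u c → sumℚ-*ʳ u c g
  ; respects    = λ u w u≈w → sumℚ-cong u w valid u≈w }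

-coordinate-linear : ∀ {n} q → Valid n q → Linear n (λ u → - u q)
-coordinate-linear q valid = record
  { additive    = λ u w → ℚP.neg-distrib-+ (u q) (w q)
  ; homogeneous = λ u c → ℚP.neg-distribˡ-* (u q) c
  ; respects    = λ u w u≈w → cong -_ (u≈w q valid) }

row-linear : ∀ n (W : IntMatrix) k → Linear n (λ u → (W ·ᵥ u [ n ]) k)
row-linear n W k = record
  { additive    = λ u w → trans (sumℚ-cong _ _ (pairs-valid n) (λ s _ → ℚP.*-distribˡ-+ (toℚ (W k s)) (u s) (w s)))
                                (sumℚ-+ (λ s → toℚ (W k s) * u s) (λ s → toℚ (W k s) * w s) (pairs n))
  ; homogeneous = λ u c → trans (sumℚ-cong _ _ (pairs-valid n) (λ s _ → sym (ℚP.*-assoc (toℚ (W k s)) (u s) c)))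
                                (sumℚ-*ʳ (λ s → toℚ (W k s) * u s) c (pairs n))
  ; respects    = λ u w u≈w → sumℚ-cong _ _ (pairs-valid n) (λ s valid → cong (toℚ (W k s) *_) (u≈w s valid)) }

basis : Pair → Vect
basis q = fromℕ ∘ 𝟙 q

basis-self : ∀ q → basis q q ≡ 1ℚ
basis-self q = cong fromℕ (𝟙-self q)

basis-other : ∀ {q r} → ¬ q ≡ r → basis q r ≡ 0ℚ
basis-other q≢r = cong fromℕ (𝟙-other q≢r)

combination-basis : ∀ n V q → Valid n q → ∀ r → combination V (basis q) (pairs n) r ≡ column V q r
combination-basis n V q valid r = trans
  (sumℚ-single (λ s → toℚ (V r s) * basis q s) q (pairs n)
    (λ s _ s≢q → trans (cong (toℚ (V r s) *_) (basis-other (s≢q ∘ sym))) (ℚP.*-zeroʳ (toℚ (V r s))))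
    (occurrences-pairs-valid n q valid))
  (trans (cong (toℚ (V r q) *_) (basis-self q)) (ℚP.*-identityʳ _))

module SimpleVertex {n a x} (x∈P : InP n a x) (V W : IntMatrix) (WV≡I : IsRightInverse n W V)
  (cone : ∀ v → InTangentCone n a x v ⇔ Σ Vect (λ c → (∀ s → Valid n s → 0ℚ ℚ.≤ c s) × (v ≈[ n ] (V ·ᵥ c [ n ]))))
  where

  coordinate : Pair → Vect → ℚ
  coordinate k u = (W ·ᵥ u [ n ]) k

  coordinate-linear : ∀ k → Linear n (coordinate k)
  coordinate-linear = row-linear n W

  coordinate-column : ∀ k m → coordinate k (column V m) ≡ toℚ (matMul n W V k m)
  coordinate-column k m = trans (sumℚ-cong _ _ (pairs-valid n) (λ s _ → sym (toℚ-homo-* (W k s) (V s m))))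
                                (sym (toℚ-sum (λ s → W k s ℤ.* V s m) (pairs n)))

  coordinate-basis : ∀ k q → Valid n q → coordinate k (basis q) ≡ toℚ (W k q)
  coordinate-basis k q valid = combination-basis n W q valid k

  column∈cone : ∀ m → Valid n m → InTangentCone n a x (column V m)
  column∈cone m valid = Equivalence.from (cone (column V m))
    (basis m , (λ s _ → fromℕ-nonNeg (𝟙 m s)) , (λ r _ → sym (combination-basis n V m valid r)))

  Maximal : (Vect → ℚ) → Set
  Maximal f = ∀ z → InP n a z → f z ℚ.≤ f x

  maximal⇒cone≤0 : ∀ {f} → Linear n f → Maximal f → ∀ v → InTangentCone n a x v → f v ℚ.≤ 0ℚ
  maximal⇒cone≤0 {f} F max v (t , 0<t , x+tv∈P) =
    ℚP.*-cancelʳ-≤-pos t {{ℚ.positive 0<t}} (subst (f v * t ℚ.≤_) (sym (ℚP.*-zeroˡ t)) fv*t≤0)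
    where
    fv*t≤0 : f v * t ℚ.≤ 0ℚ
    fv*t≤0 = +-cancelˡ-≤ (f x) (subst₂ ℚ._≤_ (Linear.shift F x v t) (sym (ℚP.+-identityʳ (f x))) (max _ x+tv∈P))

  -- y − x = V c with c ≥ 0, and 0 = f(y − x) = Σ f(v_m) c_m is a sum of
  -- nonpositive terms, so c_k = 0.  The vector y − x is kept as an explicit λ:
  -- naming it would make Agda normalise rational arithmetic when comparing types.
  face-coordinate≡0 : ∀ {f} → Linear n f → Maximal f → ∀ y → InP n a y → f y ≡ f x →
                      ∀ k → Valid n k → ¬ f (column V k) ≡ 0ℚ → coordinate k (λ r → y r - x r) ≡ 0ℚ
  face-coordinate≡0 {f} F max y y∈P fy≡fx k valid-k fvₖ≢0 = begin
      coordinate k (λ r → y r - x r)                              ≡⟨ Linear.respects (coordinate-linear k) _ _ y-x≈Vc ⟩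
      coordinate k (V ·ᵥ c [ n ])                                 ≡⟨ Linear-combination (coordinate-linear k) V c (pairs n) ⟩
      sumℚ (map (λ m → coordinate k (column V m) * c m) (pairs n)) ≡⟨ sumℚ-zero _ (pairs n) (λ m m∈ → term≡0 m (∈pairs⇒Valid n m∈)) ⟩
      0ℚ                                                          ∎
    where
    open ≡-Reasoning
    y-x∈cone : InTangentCone n a x (λ r → y r - x r)
    y-x∈cone = 1ℚ , ℚP.positive⁻¹ 1ℚ , InP-resp (λ r _ → sym (x+1*[y-x]≡y (x r) (y r))) y∈P
    c = proj₁ (Equivalence.to (cone _) y-x∈cone)
    c≥0 = proj₁ (proj₂ (Equivalence.to (cone _) y-x∈cone))
    y-x≈Vc = proj₂ (proj₂ (Equivalence.to (cone _) y-x∈cone))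
    terms≤0 : ∀ m → m ∈ pairs n → f (column V m) * c m ℚ.≤ 0ℚ
    terms≤0 m m∈ = let valid = ∈pairs⇒Valid n m∈ in
      nonPos*nonNeg≤0 (maximal⇒cone≤0 F max (column V m) (column∈cone m valid)) (c≥0 m valid)
    terms-sum≡0 : sumℚ (map (λ m → f (column V m) * c m) (pairs n)) ≡ 0ℚ
    terms-sum≡0 = begin
      sumℚ (map (λ m → f (column V m) * c m) (pairs n)) ≡⟨ Linear-combination F V c (pairs n) ⟨
      f (V ·ᵥ c [ n ])                                   ≡⟨ Linear.respects F _ _ y-x≈Vc ⟨
      f (λ r → y r - x r)                                ≡⟨ Linear.sub F y x ⟩
      f y - f x                                          ≡⟨ cong (_- f x) fy≡fx ⟩
      f x - f x                                          ≡⟨ ℚP.+-inverseʳ (f x) ⟩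
      0ℚ                                                 ∎
    cₖ≡0 : c k ≡ 0ℚ
    cₖ≡0 = x*y≡0⇒x≡0 (c k) (f (column V k))
      (trans (ℚP.*-comm (c k) _) (sumℚ-nonPos-≡0 _ (pairs n) terms≤0 terms-sum≡0 k (Valid⇒∈pairs n valid-k))) fvₖ≢0
    term≡0 : ∀ m → Valid n m → coordinate k (column V m) * c m ≡ 0ℚ
    term≡0 m valid-m with k ≟ₚ m
    ... | yes refl = trans (cong (coordinate k (column V k) *_) cₖ≡0) (ℚP.*-zeroʳ (coordinate k (column V k)))
    ... | no k≢m   = trans (cong (_* c m) (trans (coordinate-column k m) (cong toℚ (proj₂ (WV≡I k m valid-k valid-m) k≢m))))
                           (ℚP.*-zeroˡ (c m))
  face-column≡0 : ∀ {f} → Linear n f → Maximal f → ∀ y → InP n a y → f y ≡ f x → ∀ k p → Valid n k →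
                  (∀ u → coordinate k u ≡ toℚ (W k p) * u p) → ¬ toℚ (W k p) ≡ 0ℚ → ¬ y p ≡ x p →
                  f (column V k) ≡ 0ℚ
  face-column≡0 {f} F max y y∈P fy≡fx k p valid-k coordinate≡ Wkp≢0 yp≢xp with f (column V k) ℚP.≟ 0ℚ
  ... | yes fvₖ≡0 = fvₖ≡0
  ... | no  fvₖ≢0 = ⊥-elim (yp≢xp (x-y≡0⇒x≡y {y p} {x p} (x*y≡0⇒x≡0 (y p - x p) (toℚ (W k p))
        (trans (ℚP.*-comm (y p - x p) (toℚ (W k p))) (trans (sym (coordinate≡ (λ r → y r - x r)))
          (face-coordinate≡0 F max y y∈P fy≡fx k valid-k fvₖ≢0))) Wkp≢0)))

-- Surgery on Dyck paths

∈-tail : ∀ {h c} {t : List Pair} → c ∈ h ∷ t → h ≺ c → c ∈ t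
∈-tail (here refl) h≺h = ⊥-elim (≺-irrefl h≺h)
∈-tail (there c∈t) _   = c∈t

successor : ∀ {h t v} → Linked Step (h ∷ t) → v ∈ t → Step h v → ∃ λ t′ → t ≡ v ∷ t′
successor {h} {h′ ∷ t′} (h→h′ ∷ l) v∈ h→v =
  t′ , cong (_∷ t′) (⊑∧rank≡⇒≡ (h′⊑ v∈) (trans (Step⇒rank h→h′) (sym (Step⇒rank h→v))))
  where
  h′⊑ : ∀ {v} → v ∈ h′ ∷ t′ → h′ ⊑ v
  h′⊑ (here refl) = ⊑-refl
  h′⊑ (there v∈)  = proj₁ (All.lookup (AllPairs.head (path-ordered l)) v∈)

consecutive : ∀ {d u p w} → Linked Step d → u ∈ d → p ∈ d → w ∈ d → Step u p → Step p w →
              ∃₂ λ pre post → d ≡ pre ++ u ∷ p ∷ w ∷ post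
consecutive {h ∷ t} l (here refl) p∈ w∈ u→p p→w
  with successor l (∈-tail p∈ (Step⇒≺ u→p)) u→p
... | _ , refl with successor (Linked.tail l) (∈-tail (∈-tail w∈ (≺-trans (Step⇒≺ u→p) (Step⇒≺ p→w))) (Step⇒≺ p→w)) p→w
...   | post , refl = [] , post , refl
consecutive {h ∷ t} l (there u∈t) p∈ w∈ u→p p→w =
  let pre , post , eq = consecutive (Linked.tail l) u∈t (∈-tail p∈ h≺p) (∈-tail w∈ (≺-trans h≺p (Step⇒≺ p→w))) u→p p→w
  in h ∷ pre , post , cong (h ∷_) eq
  where
  h≺p = ≺-trans (All.lookup (AllPairs.head (path-ordered l)) u∈t) (Step⇒≺ u→p)

module _ {A : Set} {R : A → A → Set} where

  Linked-++⁻ˡ : ∀ xs {ys} → Linked R (xs ++ ys) → Linked R xs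
  Linked-++⁻ˡ []           _       = []
  Linked-++⁻ˡ (x ∷ [])     _       = [-]
  Linked-++⁻ˡ (x ∷ y ∷ xs) (r ∷ l) = r ∷ Linked-++⁻ˡ (y ∷ xs) l

  Linked-++⁻ʳ : ∀ xs {ys} → Linked R (xs ++ ys) → Linked R ys
  Linked-++⁻ʳ []       l = l
  Linked-++⁻ʳ (x ∷ xs) l = Linked-++⁻ʳ xs (Linked.tail l)

  Linked-replace : ∀ xs {y ys zs} → Linked R (xs ++ y ∷ ys) → Linked R (y ∷ zs) → Linked R (xs ++ y ∷ zs)
  Linked-replace []            _       l′ = l′
  Linked-replace (x ∷ [])      (r ∷ _) l′ = r ∷ l′
  Linked-replace (x ∷ x′ ∷ xs) (r ∷ l) l′ = r ∷ Linked-replace (x′ ∷ xs) l l′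

last-++ : ∀ (xs : List Pair) y ys → last (xs ++ y ∷ ys) ≡ last (y ∷ ys)
last-++ []            y ys = refl
last-++ (x ∷ [])      y ys = refl
last-++ (x ∷ x′ ∷ xs) y ys = last-++ (x′ ∷ xs) y ys

lastRow-++ : ∀ xs y ys → lastRow (xs ++ y ∷ ys) ≡ lastRow (y ∷ ys)
lastRow-++ []            y ys = refl
lastRow-++ (x ∷ [])      y ys = refl
lastRow-++ (x ∷ x′ ∷ xs) y ys = lastRow-++ (x′ ∷ xs) y ys

firstRow-++ : ∀ xs y ys zs → firstRow (xs ++ y ∷ ys) ≡ firstRow (xs ++ y ∷ zs)
firstRow-++ []       y ys zs = refl
firstRow-++ (x ∷ xs) y ys zs = refl

StartsOnDiag-++ : ∀ xs y ys zs → StartsOnDiag (xs ++ y ∷ ys) → StartsOnDiag (xs ++ y ∷ zs)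
StartsOnDiag-++ []       y ys zs start = start
StartsOnDiag-++ (x ∷ xs) y ys zs start = start

module Flip {n pre post u p w} (D : IsDyck n (pre ++ u ∷ p ∷ w ∷ post))
            {p′} (valid-p′ : Valid n p′) (u→p′ : Step u p′) (p′→w : Step p′ w) where

  flipped : List Pair
  flipped = pre ++ u ∷ p′ ∷ w ∷ post

  flipped-IsDyck : IsDyck n flipped
  flipped-IsDyck = valid , linked , StartsOnDiag-++ pre u _ _ (proj₁ (proj₂ (proj₂ D))) , ends
    where
    valid : All (Valid n) flipped
    valid with AllP.++⁻ pre (proj₁ D)
    ... | valid-pre , valid-u ∷ _ ∷ valid-rest = AllP.++⁺ valid-pre (valid-u ∷ valid-p′ ∷ valid-rest)
    linked : Linked Step flipped
    linked = Linked-replace pre (proj₁ (proj₂ D))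
      (u→p′ ∷ p′→w ∷ Linked.tail (Linked.tail (Linked-++⁻ʳ pre (proj₁ (proj₂ D)))))
    ends : EndsOnDiag flipped
    ends = let i , eq = proj₂ (proj₂ (proj₂ D)) in
      i , trans (last-++ pre u (p′ ∷ w ∷ post)) (trans (sym (last-++ pre u (p ∷ w ∷ post))) eq)

  flipped-M : ∀ a → M a flipped ≡ M a (pre ++ u ∷ p ∷ w ∷ post)
  flipped-M a = cong₂ (λ lo hi → fromℕ (Mℕ a lo hi)) (firstRow-++ pre u _ _)
    (trans (lastRow-++ pre u (p′ ∷ w ∷ post)) (sym (lastRow-++ pre u (p ∷ w ∷ post))))

  flipped-S : ∀ v → S v (pre ++ u ∷ p ∷ w ∷ post) + v p′ ≡ S v flipped + v p
  flipped-S v = begin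
      S v (pre ++ u ∷ p ∷ w ∷ post) + v p′
    ≡⟨ cong (_+ v p′) (S-++ v pre (u ∷ p ∷ w ∷ post)) ⟩
      (S v pre + (v u + (v p + S v (w ∷ post)))) + v p′
    ≡⟨ exchange (S v pre) (v u) (v p) (S v (w ∷ post)) (v p′) ⟩
      (S v pre + (v u + (v p′ + S v (w ∷ post)))) + v p
    ≡⟨ cong (_+ v p) (S-++ v pre (u ∷ p′ ∷ w ∷ post)) ⟨
      S v flipped + v p ∎
    where
    open ≡-Reasoning
    exchange : ∀ a b c d e → (a + (b + (c + d))) + e ≡ (a + (b + (e + d))) + c
    exchange = ℚ+-Solver.solve 5 (λ a b c d e → (a ⊕ (b ⊕ (c ⊕ d))) ⊕ e ⊜ (a ⊕ (b ⊕ (e ⊕ d))) ⊕ c) refl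

module DiagonalSplit {n pre post i p j} (D : IsDyck n (pre ++ (i , suc i) ∷ p ∷ (j , suc j) ∷ post)) where

  before : List Pair
  before = pre ++ [ (i , suc i) ]

  after : List Pair
  after = (j , suc j) ∷ post

  whole≡ : pre ++ (i , suc i) ∷ p ∷ (j , suc j) ∷ post ≡ before ++ p ∷ after
  whole≡ = sym (ListP.++-assoc pre [ (i , suc i) ] (p ∷ after))

  before-IsDyck : IsDyck n before
  before-IsDyck =
    AllP.++⁻ˡ before (subst (All (Valid n)) whole≡ (proj₁ D)) ,
    Linked-++⁻ˡ before (subst (Linked Step) whole≡ (proj₁ (proj₂ D))) ,
    StartsOnDiag-++ pre (i , suc i) _ [] (proj₁ (proj₂ (proj₂ D))) ,
    i , last-++ pre (i , suc i) []

  after-IsDyck : IsDyck n after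
  after-IsDyck =
    AllP.++⁻ʳ (before ++ [ p ]) (subst (All (Valid n)) (trans whole≡ (sym (ListP.++-assoc before [ p ] after))) (proj₁ D)) ,
    Linked.tail (Linked.tail (Linked-++⁻ʳ pre (proj₁ (proj₂ D)))) ,
    refl ,
    proj₁ (proj₂ (proj₂ (proj₂ D))) , trans (sym (last-++ pre (i , suc i) (p ∷ after))) (proj₂ (proj₂ (proj₂ (proj₂ D))))

  S-split : ∀ v → S v (pre ++ (i , suc i) ∷ p ∷ (j , suc j) ∷ post) ≡ S v before + (v p + S v after)
  S-split v = trans (cong (S v) whole≡) (S-++ v before (p ∷ after))

  firstRow-before : firstRow before ≡ firstRow (pre ++ (i , suc i) ∷ p ∷ (j , suc j) ∷ post)
  firstRow-before = firstRow-++ pre (i , suc i) _ _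

  lastRow-before : lastRow before ≡ i
  lastRow-before = lastRow-++ pre (i , suc i) []

  lastRow-after : lastRow after ≡ lastRow (pre ++ (i , suc i) ∷ p ∷ (j , suc j) ∷ post)
  lastRow-after = sym (lastRow-++ pre (i , suc i) (p ∷ after))

-- The argument at a vanishing coordinate

sum≢0⇒term≢0 : ∀ (h : Pair → ℤ) L → ¬ foldr ℤ._+_ (ℤ.+ 0) (map h L) ≡ ℤ.+ 0 → ∃ λ s → s ∈ L × ¬ h s ≡ ℤ.+ 0
sum≢0⇒term≢0 h []      sum≢0 = ⊥-elim (sum≢0 refl)
sum≢0⇒term≢0 h (s ∷ L) sum≢0 with h s ℤ.≟ ℤ.+ 0
... | no hs≢0 = s , here refl , hs≢0
... | yes hs≡0 = let s′ , s′∈ , hs′≢0 = sum≢0⇒term≢0 h L rest≢0 in s′ , there s′∈ , hs′≢0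
  where
  rest = foldr ℤ._+_ (ℤ.+ 0) (map h L)
  rest≢0 : ¬ rest ≡ ℤ.+ 0
  rest≢0 eq = sum≢0 (trans (cong (ℤ._+ rest) hs≡0) (trans (ℤP.+-identityˡ rest) eq))

-x≤0⇒0≤x : ∀ {x} → - x ℚ.≤ 0ℚ → 0ℚ ℚ.≤ x
-x≤0⇒0≤x {x} -x≤0 = subst₂ ℚ._≤_ (ℚP.+-inverseˡ x) (ℚP.+-identityˡ x) (ℚP.+-monoˡ-≤ x -x≤0)

step-covers : ∀ {n u p} → proj₁ u < proj₂ u → Valid n p → Step u p → Covers p (suc (proj₁ u))
step-covers _     (_ , p₁<p₂ , _) (inj₁ (refl , refl)) = ℕP.≤-refl , p₁<p₂
step-covers u₁<u₂ _               (inj₂ (refl , refl)) = ℕP.n≤1+n _ , s≤s u₁<u₂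

module ZeroCoordinate {n a} (a-pos : ∀ k → 1 ≤ k → k ≤ n ∸ 1 → 1 ≤ a k) {x} (simple : IsSimpleVertex n a x)
                      {p} (valid-p : Valid n p) (xₚ≡0 : x p ≡ 0ℚ) where

  private
    x∈P  = proj₁ (proj₁ simple)
    V    = proj₁ (proj₂ simple)
    W    = proj₁ (proj₂ (proj₂ simple))
    WV≡I = proj₁ (proj₂ (proj₂ (proj₂ simple)))
    VW≡I = proj₁ (proj₂ (proj₂ (proj₂ (proj₂ simple))))
    cone = proj₂ (proj₂ (proj₂ (proj₂ (proj₂ simple))))

  open SimpleVertex x∈P V W WV≡I cone

  1≤a : ∀ k → 1 ≤ k → k < n → 1 ≤ a k
  1≤a k 1≤k k<n = a-pos k 1≤k (ℕP.∸-monoˡ-≤ 1 k<n)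

  0∈P : InP n a (λ _ → 0ℚ)
  0∈P = integer-point-∈P n a (λ _ → 0) (λ e _ → subst (_≤ Mℕ a (firstRow e) (lastRow e)) (sym (zeros e)) z≤n)
    where
    zeros : ∀ (e : List Pair) → sumℕ (map (λ _ → 0) e) ≡ 0
    zeros []      = refl
    zeros (_ ∷ e) = zeros e

  basis∈P : ∀ q → InP n a (basis q)
  basis∈P q = integer-point-∈P n a (𝟙 q) bounded
    where
    bounded : ∀ e → IsDyck n e → occurrences q e ≤ Mℕ a (firstRow e) (lastRow e)
    bounded e E = ℕP.≤-trans (occurrences≤1 {q} E.ordered) (ℕP.≤-trans
      (1≤a (firstRow e) E.1≤firstRow (ℕP.≤-<-trans E.firstRow≤lastRow E.lastRow<n))
      (≤-Mℕ a (suc n) (firstRow e) (lastRow e) E.firstRow≤lastRow (ℕP.m≤n⇒m≤1+n E.lastRow<n)))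
      where module E = DyckPath E

  -coordinate-maximal : ∀ {q} → Valid n q → x q ≡ 0ℚ → Maximal (λ u → - u q)
  -coordinate-maximal {q} valid x_q≡0 z z∈P = subst (λ t → - z q ℚ.≤ - t) (sym x_q≡0) (ℚP.neg-antimono-≤ (proj₁ z∈P q valid))

  S-maximal : ∀ {g} → IsDyck n g → S x g ≡ M a g → Maximal (λ u → S u g)
  S-maximal {g} G tight z z∈P = subst (S z g ℚ.≤_) (sym tight) (proj₂ z∈P g G)

  generator : ∃ λ k → k ∈ pairs n × ¬ V p k ℤ.* W k p ≡ ℤ.+ 0
  generator = sum≢0⇒term≢0 (λ s → V p s ℤ.* W s p) (pairs n)
    (λ eq → 1≢0 (trans (sym (proj₁ (VW≡I p p valid-p valid-p) refl)) eq))
    where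
    1≢0 : ¬ ℤ.+ 1 ≡ ℤ.+ 0
    1≢0 ()

  k : Pair
  k = proj₁ generator

  valid-k : Valid n k
  valid-k = ∈pairs⇒Valid n (proj₁ (proj₂ generator))

  Vₚₖ≢0 : ¬ toℚ (V p k) ≡ 0ℚ
  Vₚₖ≢0 eq = proj₂ (proj₂ generator) (trans (cong (ℤ._* W k p) (toℚ≡0⇒≡0 (V p k) eq)) (ℤP.*-zeroˡ (W k p)))

  -Vₚₖ≢0 : ¬ - column V k p ≡ 0ℚ
  -Vₚₖ≢0 eq = Vₚₖ≢0 (ℚP.neg-injective eq)

  coordinate-face : ∀ y → InP n a y → y p ≡ 0ℚ → coordinate k y ≡ coordinate k x
  coordinate-face y y∈P yₚ≡0 = x-y≡0⇒x≡y (trans (sym (Linear.sub (coordinate-linear k) y x))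
    (face-coordinate≡0 (-coordinate-linear p valid-p) (-coordinate-maximal valid-p xₚ≡0) y y∈P
      (cong -_ (trans yₚ≡0 (sym xₚ≡0))) k valid-k -Vₚₖ≢0))

  Wₖ≡0 : ∀ q → Valid n q → ¬ q ≡ p → toℚ (W k q) ≡ 0ℚ
  Wₖ≡0 q valid-q q≢p = begin
    toℚ (W k q)              ≡⟨ coordinate-basis k q valid-q ⟨
    coordinate k (basis q)   ≡⟨ coordinate-face (basis q) (basis∈P q) (basis-other q≢p) ⟩
    coordinate k x           ≡⟨ coordinate-face (λ _ → 0ℚ) 0∈P refl ⟨
    coordinate k (λ _ → 0ℚ)  ≡⟨ Linear.preserves-0 (coordinate-linear k) ⟩
    0ℚ                       ∎
    where open ≡-Reasoning

  coordinate≡ : ∀ u → coordinate k u ≡ toℚ (W k p) * u p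
  coordinate≡ u = sumℚ-single (λ s → toℚ (W k s) * u s) p (pairs n)
    (λ s s∈ s≢p → trans (cong (_* u s) (Wₖ≡0 s (∈pairs⇒Valid n s∈) s≢p)) (ℚP.*-zeroˡ (u s)))
    (occurrences-pairs-valid n p valid-p)

  Wₖₚ≢0 : ¬ toℚ (W k p) ≡ 0ℚ
  Wₖₚ≢0 eq = ℚP.1≢0 (begin
    1ℚ                                  ≡⟨ cong toℚ (proj₁ (WV≡I k k valid-k valid-k) refl) ⟨
    toℚ (matMul n W V k k)              ≡⟨ coordinate-column k k ⟨
    coordinate k (column V k)           ≡⟨ coordinate≡ (column V k) ⟩
    toℚ (W k p) * toℚ (V p k)           ≡⟨ cong (_* toℚ (V p k)) eq ⟩
    0ℚ * toℚ (V p k)                    ≡⟨ ℚP.*-zeroˡ (toℚ (V p k)) ⟩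
    0ℚ                                  ∎)
    where open ≡-Reasoning

  0≤Vₚₖ : 0ℚ ℚ.≤ toℚ (V p k)
  0≤Vₚₖ = -x≤0⇒0≤x (maximal⇒cone≤0 (-coordinate-linear p valid-p) (-coordinate-maximal valid-p xₚ≡0) (column V k) (column∈cone k valid-k))

  tight⇒S≤0 : ∀ {g} → IsDyck n g → S x g ≡ M a g → S (column V k) g ℚ.≤ 0ℚ
  tight⇒S≤0 G tight = maximal⇒cone≤0 (S-linear _ (proj₁ G)) (S-maximal G tight) (column V k) (column∈cone k valid-k)

  tight⇒S≢Vₚₖ : ∀ {g} → IsDyck n g → S x g ≡ M a g → ¬ S (column V k) g ≡ toℚ (V p k)
  tight⇒S≢Vₚₖ G tight eq = Vₚₖ≢0 (ℚP.≤-antisym (subst (ℚ._≤ 0ℚ) eq (tight⇒S≤0 G tight)) 0≤Vₚₖ)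

  tight⇒S≡0 : ∀ {g} → IsDyck n g → S x g ≡ M a g → ∀ k₀ r → Covers p k₀ →
              (firstRow g ≤ k₀ → k₀ ≤ lastRow g → r ∈ g × Covers r k₀ × ¬ r ⊑ p × ¬ p ⊑ r) →
              S (column V k) g ≡ 0ℚ
  tight⇒S≡0 {g} G tight k₀ r p-covers witness =
    face-column≡0 (S-linear g (proj₁ G)) (S-maximal G tight) y y∈P (trans y-tight (sym tight)) k p valid-k
      coordinate≡ Wₖₚ≢0 yₚ≢xₚ
    where
    p-row = proj₁ p-covers
    k₀<n = ℕP.<-≤-trans (proj₂ p-covers) (proj₂ (proj₂ valid-p))
    point = tight-integer-point n a G p k₀ r (1≤a k₀ (ℕP.≤-trans (proj₁ valid-p) p-row) k₀<n) p-covers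
              (proj₂ (proj₂ valid-p)) witness
    y = fromℕ ∘ proj₁ point
    y∈P = proj₁ (proj₂ point)
    y-tight = proj₁ (proj₂ (proj₂ point))
    yₚ≢xₚ : ¬ y p ≡ x p
    yₚ≢xₚ eq = ℕP.n≮0 (subst (1 ≤_) (fromℕ≡0⇒≡0 _ (trans eq xₚ≡0)) (proj₂ (proj₂ (proj₂ point))))

  flip⇒⊥ : ∀ {pre post u w p′} → IsDyck n (pre ++ u ∷ p ∷ w ∷ post) →
           S x (pre ++ u ∷ p ∷ w ∷ post) ≡ M a (pre ++ u ∷ p ∷ w ∷ post) →
           Valid n p′ → Step u p′ → Step p′ w → ¬ p′ ≡ p → ⊥
  flip⇒⊥ {pre} {post} {u} {w} {p′} D tight valid-p′ u→p′ p′→w p′≢p = tight⇒S≢Vₚₖ D tight column-sum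
    where
    open Flip D valid-p′ u→p′ p′→w
    open ≡-Reasoning
    d = pre ++ u ∷ p ∷ w ∷ post
    u→p : Step u p
    u→p = Linked.head (Linked-++⁻ʳ pre (proj₁ (proj₂ D)))
    u₁<u₂ : proj₁ u < proj₂ u
    u₁<u₂ = proj₁ (proj₂ (All.lookup (proj₁ D) (∈-++⁺ʳ pre (here refl))))
    same-rank : rank p′ ≡ rank p
    same-rank = trans (Step⇒rank u→p′) (sym (Step⇒rank u→p))
    exchange : S x d + x p′ ≡ S x flipped
    exchange = trans (flipped-S x) (trans (cong (S x flipped +_) xₚ≡0) (ℚP.+-identityʳ _))
    xₚ′≡0 : x p′ ≡ 0ℚ
    xₚ′≡0 = ℚP.≤-antisym (+-cancelˡ-≤ (S x d) (subst₂ ℚ._≤_ (sym exchange) (sym (ℚP.+-identityʳ (S x d)))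
      (subst (S x flipped ℚ.≤_) (trans (flipped-M a) (sym tight)) (proj₂ x∈P flipped flipped-IsDyck))))
      (proj₁ x∈P p′ valid-p′)
    flipped-tight : S x flipped ≡ M a flipped
    flipped-tight = begin
      S x flipped         ≡⟨ exchange ⟨
      S x d + x p′        ≡⟨ cong (S x d +_) xₚ′≡0 ⟩
      S x d + 0ℚ          ≡⟨ ℚP.+-identityʳ (S x d) ⟩
      S x d               ≡⟨ tight ⟩
      M a d               ≡⟨ flipped-M a ⟨
      M a flipped         ∎
    Vₚ′ₖ≡0 : toℚ (V p′ k) ≡ 0ℚ
    Vₚ′ₖ≡0 = ℚP.neg-injective (face-column≡0 (-coordinate-linear p′ valid-p′) (-coordinate-maximal valid-p′ xₚ′≡0)
      (basis p) (basis∈P p) (cong -_ (trans (basis-other (p′≢p ∘ sym)) (sym xₚ′≡0))) k p valid-k coordinate≡ Wₖₚ≢0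
      (λ eq → ℚP.1≢0 (trans (sym (basis-self p)) (trans eq xₚ≡0))))
    flipped-S≡0 : S (column V k) flipped ≡ 0ℚ
    flipped-S≡0 = tight⇒S≡0 flipped-IsDyck flipped-tight (suc (proj₁ u)) p′ (step-covers u₁<u₂ valid-p u→p)
      (λ _ _ → ∈-++⁺ʳ pre (there (here refl)) , step-covers u₁<u₂ valid-p′ u→p′ ,
               (λ p′⊑p → p′≢p (⊑∧rank≡⇒≡ p′⊑p same-rank)) ,
               (λ p⊑p′ → p′≢p (sym (⊑∧rank≡⇒≡ p⊑p′ (sym same-rank)))))
    column-sum : S (column V k) d ≡ toℚ (V p k)
    column-sum = begin
      S (column V k) d                          ≡⟨ ℚP.+-identityʳ _ ⟨
      S (column V k) d + 0ℚ                     ≡⟨ cong (S (column V k) d +_) Vₚ′ₖ≡0 ⟨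
      S (column V k) d + toℚ (V p′ k)           ≡⟨ flipped-S (column V k) ⟩
      S (column V k) flipped + toℚ (V p k)      ≡⟨ cong (_+ toℚ (V p k)) flipped-S≡0 ⟩
      0ℚ + toℚ (V p k)                          ≡⟨ ℚP.+-identityˡ _ ⟩
      toℚ (V p k)                               ∎

  diagonal⇒⊥ : ∀ {pre post i} → p ≡ (i , suc (suc i)) →
               IsDyck n (pre ++ (i , suc i) ∷ p ∷ (suc i , suc (suc i)) ∷ post) →
               S x (pre ++ (i , suc i) ∷ p ∷ (suc i , suc (suc i)) ∷ post) ≡ M a (pre ++ (i , suc i) ∷ p ∷ (suc i , suc (suc i)) ∷ post) →
               ⊥
  diagonal⇒⊥ {pre} {post} {i} refl D tight = tight⇒S≢Vₚₖ D tight column-sum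
    where
    open DiagonalSplit D
    open ≡-Reasoning
    module D = DyckPath D
    d = pre ++ (i , suc i) ∷ p ∷ (suc i , suc (suc i)) ∷ post
    M-split : M a d ≡ M a before + M a after
    M-split = begin
      M a d                                                 ≡⟨ cong fromℕ (Mℕ-split a (suc n) (firstRow d) i (lastRow d)
                                                                 (D.firstRow≤ (∈-++⁺ʳ pre (here refl)))
                                                                 (D.≤lastRow (∈-++⁺ʳ pre (there (there (here refl)))))
                                                                 (ℕP.m≤n⇒m≤1+n D.lastRow<n)) ⟩
      fromℕ (Mℕ a (firstRow d) i ℕ.+ Mℕ a (suc i) (lastRow d)) ≡⟨ fromℕ-homo-+ (Mℕ a (firstRow d) i) (Mℕ a (suc i) (lastRow d)) ⟩
      fromℕ (Mℕ a (firstRow d) i) + fromℕ (Mℕ a (suc i) (lastRow d))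
        ≡⟨ cong₂ (λ lo hi → fromℕ (Mℕ a lo i) + fromℕ (Mℕ a (suc i) hi)) firstRow-before lastRow-after ⟨
      fromℕ (Mℕ a (firstRow before) i) + M a after           ≡⟨ cong (λ hi → fromℕ (Mℕ a (firstRow before) hi) + M a after) lastRow-before ⟨
      M a before + M a after                                ∎
    S-split′ : S x d ≡ S x before + S x after
    S-split′ = trans (S-split x) (cong (S x before +_) (trans (cong (_+ S x after) xₚ≡0) (ℚP.+-identityˡ (S x after))))
    before≤ = proj₂ x∈P before before-IsDyck
    after≤ = proj₂ x∈P after after-IsDyck
    before-tight : S x before ≡ M a before
    before-tight = +-tightˡ before≤ after≤ (trans (sym S-split′) (trans tight M-split))
    after-tight : S x after ≡ M a after
    after-tight = +-tightˡ after≤ before≤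
      (trans (ℚP.+-comm (S x after) (S x before)) (trans (sym S-split′) (trans tight (trans M-split (ℚP.+-comm (M a before) (M a after))))))
    before-S≡0 : S (column V k) before ≡ 0ℚ
    before-S≡0 = tight⇒S≡0 before-IsDyck before-tight (suc i) p (ℕP.n≤1+n i , ℕP.≤-refl)
      (λ _ 1+i≤last → ⊥-elim (ℕP.1+n≰n (subst (suc i ≤_) lastRow-before 1+i≤last)))
    after-S≡0 : S (column V k) after ≡ 0ℚ
    after-S≡0 = tight⇒S≡0 after-IsDyck after-tight i p (ℕP.≤-refl , ℕP.≤-trans (ℕP.n≤1+n (suc i)) ℕP.≤-refl)
      (λ 1+i≤i _ → ⊥-elim (ℕP.1+n≰n 1+i≤i))
    column-sum : S (column V k) d ≡ toℚ (V p k)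
    column-sum = begin
      S (column V k) d                                               ≡⟨ S-split (column V k) ⟩
      S (column V k) before + (toℚ (V p k) + S (column V k) after)  ≡⟨ cong₂ (λ s t → s + (toℚ (V p k) + t)) before-S≡0 after-S≡0 ⟩
      0ℚ + (toℚ (V p k) + 0ℚ)                                        ≡⟨ ℚP.+-identityˡ _ ⟩
      toℚ (V p k) + 0ℚ                                               ≡⟨ ℚP.+-identityʳ _ ⟩
      toℚ (V p k)                                                    ∎

module _ {n a} (a-pos : ∀ k → 1 ≤ k → k ≤ n ∸ 1 → 1 ≤ a k) {x} (simple : IsSimpleVertex n a x)
         {d} (D : IsDyck n d) (tight : S x d ≡ M a d) where

  private
    turn : ∀ {u p w} → u ∈ d → p ∈ d → w ∈ d → Step u p → Step p w →
           ∃₂ λ pre post → IsDyck n (pre ++ u ∷ p ∷ w ∷ post) × S x (pre ++ u ∷ p ∷ w ∷ post) ≡ M a (pre ++ u ∷ p ∷ w ∷ post)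
    turn u∈ p∈ w∈ u→p p→w =
      let pre , post , d≡ = consecutive (proj₁ (proj₂ D)) u∈ p∈ w∈ u→p p→w
      in pre , post , subst (IsDyck n) d≡ D , subst (λ e → S x e ≡ M a e) d≡ tight

  peak⇒x≢0 : ∀ p → IsPeak d p → ¬ x p ≡ 0ℚ
  peak⇒x≢0 (i , zero)  (p∈ , _) _ = ℕP.n≮0 (proj₁ (proj₂ (DyckPath.valid D p∈)))
  peak⇒x≢0 (i , suc j) (p∈ , u∈ , w∈) xₚ≡0 = by-cases (suc i ℕ.<? j) (ℕP.≤-antisym ∘ ℕP.≮⇒≥)
    where
    open ZeroCoordinate a-pos simple (DyckPath.valid D p∈) xₚ≡0
    valid-u = DyckPath.valid D u∈
    pre = proj₁ (turn u∈ p∈ w∈ (inj₂ (refl , refl)) (inj₁ (refl , refl)))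
    post = proj₁ (proj₂ (turn u∈ p∈ w∈ (inj₂ (refl , refl)) (inj₁ (refl , refl))))
    D′ = proj₁ (proj₂ (proj₂ (turn u∈ p∈ w∈ (inj₂ (refl , refl)) (inj₁ (refl , refl)))))
    tight′ = proj₂ (proj₂ (proj₂ (turn u∈ p∈ w∈ (inj₂ (refl , refl)) (inj₁ (refl , refl)))))
    by-cases : Dec (suc i < j) → (¬ suc i < j → suc i ≤ j → j ≡ suc i) → ⊥
    by-cases (yes 1+i<j) _ = flip⇒⊥ D′ tight′ (s≤s z≤n , 1+i<j , proj₂ (proj₂ valid-u))
      (inj₁ (refl , refl)) (inj₂ (refl , refl)) (λ eq → ℕP.1+n≢n (cong proj₁ eq))
    by-cases (no 1+i≮j) on-diagonal with on-diagonal 1+i≮j (proj₁ (proj₂ valid-u))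
    ... | refl = diagonal⇒⊥ refl D′ tight′

  valley⇒x≢0 : ∀ p → IsValley d p → ¬ x p ≡ 0ℚ
  valley⇒x≢0 (zero , j)  (p∈ , _) _ = ℕP.n≮0 (proj₁ (DyckPath.valid D p∈))
  valley⇒x≢0 (suc i , j) (p∈ , u∈ , w∈) xₚ≡0 =
    flip⇒⊥ (proj₁ (proj₂ (proj₂ corner))) (proj₂ (proj₂ (proj₂ corner))) valid-p′
      (inj₂ (refl , refl)) (inj₁ (refl , refl)) (λ eq → ℕP.1+n≢n (sym (cong proj₁ eq)))
    where
    open ZeroCoordinate a-pos simple (DyckPath.valid D p∈) xₚ≡0
    corner = turn u∈ p∈ w∈ (inj₁ (refl , refl)) (inj₂ (refl , refl))
    valid-u = DyckPath.valid D u∈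
    valid-p′ : Valid n (i , suc j)
    valid-p′ = proj₁ valid-u , ℕP.m≤n⇒m≤1+n (proj₁ (proj₂ valid-u)) , proj₂ (proj₂ (DyckPath.valid D w∈))

lemma4p1 : (n : ℕ) → 2 ≤ n → (a : ℕ → ℕ) → (∀ k → 1 ≤ k → k ≤ n ∸ 1 → 1 ≤ a k) →
  (x : Vect) → IsSimpleVertex n a x →
  (d : List Pair) → IsDyck n d → S x d ≡ M a d →
  ∀ p → IsPeak d p ⊎ IsValley d p → ¬ (x p ≡ 0ℚ)
lemma4p1 n _ a a-pos x simple d D tight p (inj₁ peak)   = peak⇒x≢0 a-pos simple D tight p peak
lemma4p1 n _ a a-pos x simple d D tight p (inj₂ valley) = valley⇒x≢0 a-pos simple D tight p valley
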